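{- Let $\langle a_1,\dots,a_{3s},T\rangle$ be a ``yes'' instance of 3-Partition satisfying the restrictions below, and let $\mathcal{G}(\mathcal{P})$ be the Tetris game constructed below. Then there is a trajectory sequence that clears the entire gameboard of $\mathcal{G}(\mathcal{P})$ without triggering a loss.
   Context: 3-Partition: given non-negative integers $a_1,\dots,a_{3s}$ and $T$ with $T/4<a_i<T/2$ for all $i$ and $\sum_i a_i=sT$, decide whether $\{a_1,\dots,a_{3s}\}$ can be partitioned into $s$ sets each summing to $T$. The instance is further assumed to satisfy: (1) every subset summing to $T$ has exactly 3 elements; (2) $T$ is even; (3) any subset $A$ with $\sum_{a\in A}a\neq T$ has $|T-\sum_{a\in A}a|\ge 3s$. Tetris rules: $m\times n$ board of filled/unfilled squares (rows numbered from the bottom), the seven tetrominoes $\mathsf{Sq}$ (square), $\mathsf{LG},\mathsf{RG}$ (L-shaped, mirror images), $\mathsf{LS},\mathsf{RS}$ (S/Z-shaped), $\mathsf{I}$ (straight), $\mathsf{T}$; each piece enters at the top center in base orientation; the player may rotate it $\pm 90^\circ$ about its center (legal iff no overlap with filled squares), slide it one column left/right, drop it one row when the squares below are open, and fix it when some square below is filled; completely filled rows are then cleared (rows above shift down) and the game is lost if the next piece cannot enter. Construction of $\mathcal{G}(\mathcal{P})$: the board has $6s+3$ columns and $6T+22+3s+c$ rows, where the top $3s+c$ rows are empty ($c$ a constant equal to the size of the rotation neighborhood). In the bottom $6T+22$ rows: for each $j=1,\dots,s$ the columns $6(j-1)+1,\dots,6j$ form a bucket whose first and second columns are empty except that the four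 lowest rows are full, whose third column is empty, whose fourth and fifth columns are full in every row $h\not\equiv 5\pmod 6$ and empty in every row $h\equiv 5\pmod 6$, and whose sixth column is full. The last three columns (the lock): column $6s+1$ is full except that rows $6T+22$ and $6T+21$ are empty; column $6s+2$ is full except that row $6T+22$ is empty; column $6s+3$ is empty except that row $6T+21$ is full. Piece sequence: for each $i=1,\dots,3s$ in order, the pieces $\mathsf{I},\mathsf{LG},\mathsf{Sq}$, then the block $\mathsf{LG},\mathsf{LS},\mathsf{LG},\mathsf{LG},\mathsf{Sq}$ repeated $a_i$ times, then $\mathsf{Sq},\mathsf{Sq}$; after all these, $s$ copies of $\mathsf{I}$, one $\mathsf{RG}$, and $3T/2+5$ copies of $\mathsf{I}$. -}

module Defs where

open import Data.Bool.Base using (Bool; true; false; _∧_; _∨_; not; if_then_else_)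
open import Data.Nat.Base using (ℕ; zero; suc; _+_; _*_; _∸_; _≤_; _<_; _≤ᵇ_; _≡ᵇ_; ⌊_/2⌋)
open import Data.Nat.DivMod using (_%_)
open import Data.Integer.Base as ℤ using (ℤ; +_; -[1+_])
import Data.Integer.Properties as ℤP
open import Data.Fin.Base using (Fin)
import Data.Fin.Properties as FinP
open import Data.Fin.Subset using (Subset; ∣_∣)
open import Data.Vec.Base as Vec using (Vec; tabulate)
open import Data.List.Base as List
  using (List; []; _∷_; _++_; map; concat; concatMap; replicate; allFin; upTo; filterᵇ)
open import Data.Product.Base using (_×_; _,_)
open import Data.Bool.ListAction using (all; any)
open import Data.Maybe.Base using (Maybe; just; nothing)
open import Relation.Nullary.Decidable.Core using (does)
open import Relation.Binary.PropositionalEquality using (_≡_; _≢_)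
open import Data.Sum.Base using (_⊎_)

subsetSum : ∀ {n} → (Fin n → ℕ) → Subset n → ℕ
subsetSum a A = Vec.sum (tabulate (λ i → if Vec.lookup A i then a i else 0))

record Restricted3Partition (s : ℕ) (a : Fin (3 * s) → ℕ) (T : ℕ) : Set where
  field
    bounds   : ∀ i → T < 4 * a i × 2 * a i < T
    total    : Vec.sum (tabulate a) ≡ s * T
    onlyTriples : ∀ (A : Subset (3 * s)) → subsetSum a A ≡ T → ∣ A ∣ ≡ 3
    evenT    : T ≡ 2 * ⌊ T /2⌋
    gap      : ∀ (A : Subset (3 * s)) → subsetSum a A ≢ T →
               3 * s + subsetSum a A ≤ T ⊎ T + 3 * s ≤ subsetSum a A

YesInstance : (s : ℕ) → (Fin (3 * s) → ℕ) → ℕ → Set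
YesInstance s a T =
  Data.Product.Base.Σ (Fin (3 * s) → Fin s) λ f →
    ∀ (j : Fin s) → subsetSum a (tabulate (λ i → does (f i FinP.≟ j))) ≡ T
  where import Data.Product.Base

-- A board: rows (first argument) and columns (second argument) are
-- numbered from 1, rows from the bottom; true = filled.  Only the
-- cells with 1 ≤ row ≤ rows, 1 ≤ col ≤ cols are meaningful.
Board : Set
Board = ℕ → ℕ → Bool

record Dims : Set where
  constructor dims
  field
    rows cols : ℕ
open Dims public

data Piece : Set where
  Sq LG RG LS RS I Tee : Piece

-- Every piece lives in a k×k bounding box (k = 2 for Sq, 4 for I, 3
-- otherwise); it rotates about the centre of that box.
boxSize : Piece → ℕ
boxSize Sq = 2
boxSize I  = 4
boxSize _  = 3

-- Base orientation: cells as (column offset, row offset) from the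
-- bottom-left corner of the box.
baseCells : Piece → List (ℕ × ℕ)
baseCells Sq = (0 , 0) ∷ (1 , 0) ∷ (0 , 1) ∷ (1 , 1) ∷ []
baseCells I  = (0 , 2) ∷ (1 , 2) ∷ (2 , 2) ∷ (3 , 2) ∷ []
baseCells LG = (0 , 2) ∷ (0 , 1) ∷ (1 , 1) ∷ (2 , 1) ∷ []
baseCells RG = (2 , 2) ∷ (0 , 1) ∷ (1 , 1) ∷ (2 , 1) ∷ []
baseCells LS = (0 , 2) ∷ (1 , 2) ∷ (1 , 1) ∷ (2 , 1) ∷ []
baseCells RS = (1 , 2) ∷ (2 , 2) ∷ (0 , 1) ∷ (1 , 1) ∷ []
baseCells Tee = (1 , 2) ∷ (0 , 1) ∷ (1 , 1) ∷ (2 , 1) ∷ []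

rotCW : ℕ → ℕ × ℕ → ℕ × ℕ
rotCW k (x , y) = (y , k ∸ 1 ∸ x)

rotN : ℕ → ℕ → ℕ × ℕ → ℕ × ℕ
rotN k zero    c = c
rotN k (suc r) c = rotCW k (rotN k r c)

-- A falling piece: its type, number of clockwise quarter turns from the
-- base orientation, and the (column, row) of the bottom-left corner of
-- its bounding box.
record Active : Set where
  constructor active
  field
    piece : Piece
    turns : ℕ
    x y   : ℤ
open Active public

-- Absolute cells of an active piece, as (row , column).
cellsOf : Active → List (ℤ × ℤ)
cellsOf (active p r x y) =
  map (λ { (dx , dy) → (y ℤ.+ + dy , x ℤ.+ + dx) })
      (map (rotN (boxSize p) r) (baseCells p))

isOpen : Dims → Board → ℤ → ℤ → Bool
isOpen d b (+ r) (+ c) =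
  (1 ≤ᵇ r) ∧ (r ≤ᵇ rows d) ∧ (1 ≤ᵇ c) ∧ (c ≤ᵇ cols d) ∧ not (b r c)
isOpen d b _ _ = false

fits : Dims → Board → Active → Bool
fits d b a = all (λ { (r , c) → isOpen d b r c }) (cellsOf a)

data Move : Set where
  rotL rotR slideL slideR drop : Move

applyMove : Move → Active → Active
applyMove rotL   (active p r x y) = active p (r + 3) x y   -- −90° (four turns = identity)
applyMove rotR   (active p r x y) = active p (suc r) x y
applyMove slideL (active p r x y) = active p r (x ℤ.- + 1) y
applyMove slideR (active p r x y) = active p r (x ℤ.+ + 1) y
applyMove drop   (active p r x y) = active p r x (y ℤ.- + 1)

-- Entry: base orientation, box touching the top row, horizontally centred.
spawn : Dims → Piece → Active
spawn d p = active p 0 (+ (suc ⌊ cols d ∸ boxSize p /2⌋)) (+ (suc (rows d)) ℤ.- + boxSize p)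

data Reach (d : Dims) (b : Board) : Active → Active → Set where
  here : ∀ {a} → Reach d b a a
  step : ∀ {a a'} (mv : Move) → fits d b (applyMove mv a) ≡ true →
         Reach d b (applyMove mv a) a' → Reach d b a a'

eqℤ : ℤ → ℤ → Bool
eqℤ m n = does (m ℤP.≟ n)

place : Board → Active → Board
place b a r c = b r c ∨ any (λ { (r' , c') → eqℤ r' (+ r) ∧ eqℤ c' (+ c) }) (cellsOf a)

oneTo : ℕ → List ℕ
oneTo n = map suc (upTo n)

fullRow : Dims → Board → ℕ → Bool
fullRow d b r = all (λ c → b r c) (oneTo (cols d))

nth : {A : Set} → List A → ℕ → Maybe A
nth []       _       = nothing
nth (x ∷ xs) zero    = just x
nth (x ∷ xs) (suc n) = nth xs n

-- remove all completely filled rows; rows above shift down, empty rows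
-- appear at the top
clearRows : Dims → Board → Board
clearRows d b zero    c = false
clearRows d b (suc r) c with nth (filterᵇ (λ h → not (fullRow d b h)) (oneTo (rows d))) r
... | just h  = b h c
... | nothing = false

settle : Dims → Board → Active → Board
settle d b a = clearRows d (place b a)

-- Playing a sequence of pieces from board b ends (without a loss) in b':
-- each piece must be able to enter, is moved by legal moves, and is fixed
-- at a position where it cannot drop further.
data Game (d : Dims) : Board → List Piece → Board → Set where
  finish : ∀ {b} → Game d b [] b
  turn   : ∀ {b p ps b'} (a : Active) →
           fits d b (spawn d p) ≡ true →
           Reach d b (spawn d p) a →
           fits d b (applyMove drop a) ≡ false →
           Game d (settle d b a) ps b' →
           Game d b (p ∷ ps) b'

EmptyBoard : Dims → Board → Set
EmptyBoard d b = ∀ r c → 1 ≤ r → r ≤ rows d → 1 ≤ c → c ≤ cols d → b r c ≡ false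

-- size of the rotation neighbourhood (every piece rotates inside its box
-- of side ≤ 4)
rotConst : ℕ
rotConst = 4

gameDims : ℕ → ℕ → Dims
gameDims s T = dims (6 * T + 22 + 3 * s + rotConst) (6 * s + 3)

bucketCol : ℕ → ℕ → Bool
bucketCol 0 h = h ≤ᵇ 4
bucketCol 1 h = h ≤ᵇ 4
bucketCol 2 h = false
bucketCol 3 h = not (h % 6 ≡ᵇ 5)
bucketCol 4 h = not (h % 6 ≡ᵇ 5)
bucketCol _ h = true

initBoard : ℕ → ℕ → Board
initBoard s T h c =
  if (1 ≤ᵇ h) ∧ (h ≤ᵇ 6 * T + 22) ∧ (1 ≤ᵇ c)
  then (if c ≤ᵇ 6 * s then bucketCol ((c ∸ 1) % 6) h
        else if c ≡ᵇ 6 * s + 1 then h ≤ᵇ 6 * T + 20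
        else if c ≡ᵇ 6 * s + 2 then h ≤ᵇ 6 * T + 21
        else if c ≡ᵇ 6 * s + 3 then h ≡ᵇ 6 * T + 21
        else false)
  else false

fillerBlock : List Piece
fillerBlock = LG ∷ LS ∷ LG ∷ LG ∷ Sq ∷ []

pieceSeq : (s : ℕ) → (Fin (3 * s) → ℕ) → ℕ → List Piece
pieceSeq s a T =
  concatMap (λ i → (I ∷ LG ∷ Sq ∷ []) ++ concat (replicate (a i) fillerBlock) ++ (Sq ∷ Sq ∷ []))
            (allFin (3 * s))
  ++ replicate s I ++ RG ∷ replicate (3 * ⌊ T /2⌋ + 5) I

{-# OPTIONS --safe #-}
module Submission where

-- The board is tracked through a profile: for every bucket, the heights of its
-- three open columns and the number of filled notch rows in its two notched
-- columns.  Until the last phase every piece lands in a bucket, and the lock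
-- leaves a hole in every row, so no row is cleared.  The pieces of a_i, sent to
-- the bucket of the part containing i, raise that bucket by a_i + 1 levels of
-- six rows and restore its shape; as every part is a triple summing to T, all
-- buckets reach level T + 3.  One I per bucket then fills it to row 6T+22, the
-- RG piece completes the top two rows in the lock, and the remaining 6T+20 rows,
-- full except for the last column, are cleared four at a time by vertical I
-- pieces.

open import Defs
open import Data.Nat.Base using (ℕ; _*_; _≤_)
open import Data.Fin.Base using (Fin)
open import Data.Product.Base using (Σ; _×_)

open import Data.Bool.Base using (Bool; true; false; _∧_; _∨_; not; if_then_else_; T)
open import Data.Bool.ListAction using (all; any)
open import Data.Bool.Properties as B using (T-≡; ∧-zeroʳ; ∨-identityʳ; ∨-zeroʳ; ∧-comm)
open import Data.Empty using (⊥-elim)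
import Data.Fin.Base as F
import Data.Fin.Properties as FP
open import Data.Fin.Subset using (Subset; ∣_∣)
open import Data.Integer.Base as ℤ using (+_; -[1+_])
open import Data.Integer.Properties using (⊖-≥)
open import Data.List.Base as L using (List; []; _∷_; _++_; map; filterᵇ; applyUpTo; replicate; concat; concatMap)
open import Data.List.Properties using (++-assoc; filter-++; filter-all; filter-none)
open import Data.List.Relation.Unary.All as All using (All; []; _∷_)
open import Data.List.Relation.Unary.All.Properties using (filter⁺)
open import Data.List.Relation.Unary.Any as Any using (Any; here; there)
open import Data.Maybe.Base using (Maybe; just; nothing)
open import Data.Nat.Base using (zero; suc; _+_; _∸_; _<_; _≤ᵇ_; _<ᵇ_; _≡ᵇ_; z≤n; s≤s; ⌊_/2⌋)
open import Data.Nat.DivMod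
  using (_/_; _%_; [m+kn]%n≡m%n; m<n⇒m%n≡m; +-distrib-/; m<n⇒m/n≡0; m*n/n≡m; m*n%n≡0; m≡m%n+[m/n]*n; m%n<n; m<n*o⇒m/o<n)
open import Data.Nat.Properties
open import Data.Nat.Tactic.RingSolver using (solve-∀)
open import Data.Product.Base using (_,_; proj₁; proj₂)
open import Data.Sum.Base using (_⊎_; inj₁; inj₂; [_,_]′)
import Data.Vec.Base as V
import Data.Vec.Properties as VP
open import Function.Base using (_∘_; _|>_; case_of_)
open import Function.Bundles using (Equivalence)
open import Relation.Binary.PropositionalEquality
open import Relation.Nullary using (yes; no; ¬_)
open import Relation.Nullary.Decidable using (T?; does)

T⇒≡true : ∀ {b} → T b → b ≡ true
T⇒≡true = Equivalence.to T-≡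

≡true⇒T : ∀ {b} → b ≡ true → T b
≡true⇒T = Equivalence.from T-≡

≤ᵇ-true : ∀ {m n} → m ≤ n → (m ≤ᵇ n) ≡ true
≤ᵇ-true p = T⇒≡true (≤⇒≤ᵇ p)

≤ᵇ-false : ∀ {m n} → n < m → (m ≤ᵇ n) ≡ false
≤ᵇ-false {m} {n} p with m ≤ᵇ n in e
... | false = refl
... | true = ⊥-elim (<⇒≱ p (≤ᵇ⇒≤ m n (≡true⇒T e)))

≤ᵇ-true⇒≤ : ∀ {m n} → (m ≤ᵇ n) ≡ true → m ≤ n
≤ᵇ-true⇒≤ {m} {n} e = ≤ᵇ⇒≤ m n (≡true⇒T e)

<ᵇ-true : ∀ {m n} → m < n → (m <ᵇ n) ≡ true
<ᵇ-true p = T⇒≡true (<⇒<ᵇ p)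

<ᵇ-false : ∀ {m n} → n ≤ m → (m <ᵇ n) ≡ false
<ᵇ-false {m} {n} p with m <ᵇ n in e
... | false = refl
... | true = ⊥-elim (<⇒≱ (<ᵇ⇒< m n (≡true⇒T e)) p)

≡ᵇ-true : ∀ {m n} → m ≡ n → (m ≡ᵇ n) ≡ true
≡ᵇ-true {m} {n} p = T⇒≡true (≡⇒≡ᵇ m n p)

≡ᵇ-false : ∀ {m n} → m ≢ n → (m ≡ᵇ n) ≡ false
≡ᵇ-false {m} {n} p with m ≡ᵇ n in e
... | false = refl
... | true = ⊥-elim (p (≡ᵇ⇒≡ m n (≡true⇒T e)))

≡ᵇ-true⇒≡ : ∀ {m n} → (m ≡ᵇ n) ≡ true → m ≡ n
≡ᵇ-true⇒≡ {m} {n} e = ≡ᵇ⇒≡ m n (≡true⇒T e)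

≡ᵇ-refl : ∀ n → (n ≡ᵇ n) ≡ true
≡ᵇ-refl n = ≡ᵇ-true {n} refl

upFrom : ℕ → ℕ → List ℕ
upFrom a zero = []
upFrom a (suc n) = a ∷ upFrom (suc a) n

oneTo≡upFrom : ∀ n → oneTo n ≡ upFrom 1 n
oneTo≡upFrom n = map-suc n (λ i → i) 0 (λ i → refl)
  where
  map-suc : ∀ n (f : ℕ → ℕ) a → (∀ i → f i ≡ a + i) → map suc (applyUpTo f n) ≡ upFrom (suc a) n
  map-suc zero f a eq = refl
  map-suc (suc n) f a eq = cong₂ _∷_ (cong suc (trans (eq 0) (+-identityʳ a)))
    (map-suc n (λ i → f (suc i)) (suc a) (λ i → trans (eq (suc i)) (+-suc a i)))

upFrom-++ : ∀ a m n → upFrom a (m + n) ≡ upFrom a m ++ upFrom (a + m) n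
upFrom-++ a zero n = cong (λ x → upFrom x n) (sym (+-identityʳ a))
upFrom-++ a (suc m) n = cong (a ∷_) (trans (upFrom-++ (suc a) m n) (cong (λ x → upFrom (suc a) m ++ upFrom x n) (sym (+-suc a m))))

All-upFrom : ∀ a n → All (λ h → a ≤ h × h < a + n) (upFrom a n)
All-upFrom a zero = []
All-upFrom a (suc n) = (≤-refl , subst (a <_) (sym (+-suc a n)) (s≤s (m≤m+n a n)))
  ∷ All.map (λ {h} (p , q) → (<⇒≤ p , subst (h <_) (sym (+-suc a n)) q)) (All-upFrom (suc a) n)

Any-upFrom : ∀ {P : ℕ → Set} a n c → a ≤ c → c < a + n → P c → Any P (upFrom a n)
Any-upFrom a zero c p q pc = ⊥-elim (<⇒≱ q (subst (_≤ c) (sym (+-identityʳ a)) p))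
Any-upFrom a (suc n) c p q pc with a ≟ c
... | yes refl = here pc
... | no ne = there (Any-upFrom (suc a) n c (≤∧≢⇒< p ne) (subst (c <_) (+-suc a n) q) pc)

Any-oneTo : ∀ {P : ℕ → Set} n c → 1 ≤ c → c ≤ n → P c → Any P (oneTo n)
Any-oneTo {P} n c p q pc = subst (Any P) (sym (oneTo≡upFrom n)) (Any-upFrom 1 n c p (s≤s q) pc)

length-upFrom : ∀ a n → L.length (upFrom a n) ≡ n
length-upFrom a zero = refl
length-upFrom a (suc n) = cong suc (length-upFrom (suc a) n)

All-oneTo : ∀ n → All (λ h → 1 ≤ h × h ≤ n) (oneTo n)
All-oneTo n rewrite oneTo≡upFrom n = All.map (λ { (p , s≤s q) → p , q }) (All-upFrom 1 n)

nth-++ˡ : ∀ {A : Set} (xs ys : List A) i → i < L.length xs → nth (xs ++ ys) i ≡ nth xs i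
nth-++ˡ (x ∷ xs) ys zero p = refl
nth-++ˡ (x ∷ xs) ys (suc i) (s≤s p) = nth-++ˡ xs ys i p

nth-++ʳ : ∀ {A : Set} (xs ys : List A) i → L.length xs ≤ i → nth (xs ++ ys) i ≡ nth ys (i ∸ L.length xs)
nth-++ʳ [] ys i p = refl
nth-++ʳ (x ∷ xs) ys (suc i) (s≤s p) = nth-++ʳ xs ys i p

nth-upFrom : ∀ a n i → i < n → nth (upFrom a n) i ≡ just (a + i)
nth-upFrom a (suc n) zero p = cong just (sym (+-identityʳ a))
nth-upFrom a (suc n) (suc i) (s≤s p) = trans (nth-upFrom (suc a) n i p) (cong just (sym (+-suc a i)))

nth-upFrom-beyond : ∀ a n i → n ≤ i → nth (upFrom a n) i ≡ nothing
nth-upFrom-beyond a zero i p = refl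
nth-upFrom-beyond a (suc n) (suc i) (s≤s p) = nth-upFrom-beyond (suc a) n i p

nth-All : ∀ {A : Set} {P : A → Set} {xs : List A} i {x} → All P xs → nth xs i ≡ just x → P x
nth-All zero (px ∷ _) refl = px
nth-All (suc i) (_ ∷ ps) e = nth-All i ps e

filterᵇ-all : ∀ {A : Set} (p : A → Bool) {xs : List A} → All (λ x → p x ≡ true) xs → filterᵇ p xs ≡ xs
filterᵇ-all p = filter-all (T? ∘ p) ∘ All.map ≡true⇒T

filterᵇ-none : ∀ {A : Set} (p : A → Bool) {xs : List A} → All (λ x → p x ≡ false) xs → filterᵇ p xs ≡ []
filterᵇ-none p = filter-none (T? ∘ p) ∘ All.map (λ e → subst T e)

filterᵇ-cong : ∀ {A : Set} (p q : A → Bool) {xs : List A} → All (λ x → p x ≡ q x) xs → filterᵇ p xs ≡ filterᵇ q xs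
filterᵇ-cong p q [] = refl
filterᵇ-cong p q {x ∷ xs} (e ∷ es) with p x | q x
... | true | true = cong (x ∷_) (filterᵇ-cong p q es)
... | false | false = filterᵇ-cong p q es

all-congᴬ : ∀ {A : Set} (p q : A → Bool) {xs : List A} → All (λ x → p x ≡ q x) xs → all p xs ≡ all q xs
all-congᴬ p q [] = refl
all-congᴬ p q (e ∷ es) = cong₂ _∧_ e (all-congᴬ p q es)

all-cong : ∀ {A : Set} {p q : A → Bool} → (∀ x → p x ≡ q x) → ∀ xs → all p xs ≡ all q xs
all-cong e [] = refl
all-cong e (x ∷ xs) = cong₂ _∧_ (e x) (all-cong e xs)

any-cong : ∀ {A : Set} {p q : A → Bool} → (∀ x → p x ≡ q x) → ∀ xs → any p xs ≡ any q xs
any-cong e [] = refl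
any-cong e (x ∷ xs) = cong₂ _∨_ (e x) (any-cong e xs)

all≡true : ∀ {A : Set} (p : A → Bool) {xs : List A} → All (λ x → p x ≡ true) xs → all p xs ≡ true
all≡true p [] = refl
all≡true p (e ∷ es) rewrite e = all≡true p es

all≡false : ∀ {A : Set} (p : A → Bool) {xs : List A} → Any (λ x → p x ≡ false) xs → all p xs ≡ false
all≡false p (here e) rewrite e = refl
all≡false p {x ∷ xs} (there a) rewrite all≡false p a = ∧-zeroʳ (p x)

any≡false : ∀ {A : Set} (p : A → Bool) {xs : List A} → All (λ x → p x ≡ false) xs → any p xs ≡ false
any≡false p [] = refl
any≡false p (e ∷ es) rewrite e = any≡false p es

any≡true : ∀ {A : Set} (P : A → Bool) {xs} → Any (λ x → P x ≡ true) xs → any P xs ≡ true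
any≡true P (here e) rewrite e = refl
any≡true P {x ∷ xs} (there a) rewrite any≡true P a = ∨-zeroʳ (P x)

any-map : ∀ {A B : Set} (p : B → Bool) (f : A → B) xs → any p (map f xs) ≡ any (λ x → p (f x)) xs
any-map p f [] = refl
any-map p f (x ∷ xs) = cong (p (f x) ∨_) (any-map p f xs)

all-map : ∀ {A B : Set} (p : B → Bool) (f : A → B) xs → all p (map f xs) ≡ all (λ x → p (f x)) xs
all-map p f [] = refl
all-map p f (x ∷ xs) = cong (p (f x) ∧_) (all-map p f xs)

if-true : ∀ {A : Set} {b} {x y : A} → b ≡ true → (if b then x else y) ≡ x
if-true refl = refl

if-false : ∀ {A : Set} {b} {x y : A} → b ≡ false → (if b then x else y) ≡ y
if-false refl = refl

∧-falseˡ : ∀ {x} y → x ≡ false → x ∧ y ≡ false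
∧-falseˡ y refl = refl

∧-trueˡ : ∀ {x} y → x ≡ true → x ∧ y ≡ y
∧-trueˡ y refl = refl

∨-trueˡ : ∀ {x} y → x ≡ true → x ∨ y ≡ true
∨-trueˡ y refl = refl

∨-falseˡ : ∀ {x} y → x ≡ false → x ∨ y ≡ y
∨-falseˡ y refl = refl

∧-falseʳ : ∀ {x y} → y ≡ false → x ∧ y ≡ false
∧-falseʳ {x} refl = ∧-zeroʳ x

∧-true⁻ : ∀ {x y} → x ∧ y ≡ true → x ≡ true × y ≡ true
∧-true⁻ {true} {true} _ = refl , refl

all≡true⇒All : ∀ {A : Set} (p : A → Bool) xs → all p xs ≡ true → All (λ x → p x ≡ true) xs
all≡true⇒All p [] _ = []
all≡true⇒All p (x ∷ xs) e with ∧-true⁻ {p x} e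
... | e1 , e2 = e1 ∷ all≡true⇒All p xs e2

any≡true⇒Any : ∀ {A : Set} (p : A → Bool) xs → any p xs ≡ true → Any (λ x → p x ≡ true) xs
any≡true⇒Any p (x ∷ xs) e with p x in eq
... | true = here eq
... | false = there (any≡true⇒Any p xs e)

≡ᵇ-cancelˡ : ∀ w a t → (w + a ≡ᵇ w + t) ≡ (a ≡ᵇ t)
≡ᵇ-cancelˡ zero a t = refl
≡ᵇ-cancelˡ (suc w) a t = ≡ᵇ-cancelˡ w a t

≤ᵇ-cong-⇔ : ∀ {m n m' n'} → (m ≤ n → m' ≤ n') → (m' ≤ n' → m ≤ n) → (m ≤ᵇ n) ≡ (m' ≤ᵇ n')
≤ᵇ-cong-⇔ {m} {n} {m'} {n'} f g with m ≤? n
... | yes p = trans (≤ᵇ-true p) (sym (≤ᵇ-true (f p)))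
... | no np = trans (≤ᵇ-false (≰⇒> np)) (sym (≤ᵇ-false (≰⇒> (λ q → np (g q)))))

≤ᵇ-cancelˡ : ∀ w t g → (w + t ≤ᵇ w + g) ≡ (t ≤ᵇ g)
≤ᵇ-cancelˡ w t g = ≤ᵇ-cong-⇔ (+-cancelˡ-≤ w t g) (+-monoʳ-≤ w)

sameBool : Bool → Bool → Bool
sameBool true true = true
sameBool false false = true
sameBool _ _ = false

sameBool⇒≡ : ∀ x y → sameBool x y ≡ true → x ≡ y
sameBool⇒≡ true true _ = refl
sameBool⇒≡ false false _ = refl

allUpTo : ℕ → (ℕ → Bool) → Bool
allUpTo zero f = f 0
allUpTo (suc M) f = f (suc M) ∧ allUpTo M f

allUpTo⇒ : ∀ M f t → allUpTo M f ≡ true → t ≤ M → f t ≡ true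
allUpTo⇒ zero f .zero e z≤n = e
allUpTo⇒ (suc M) f t e p with ∧-true⁻ {f (suc M)} e | m≤n⇒m<n∨m≡n p
... | e1 , e2 | inj₁ (s≤s q) = allUpTo⇒ M f t e2 q
... | e1 , e2 | inj₂ refl = e1

localCells : Piece → ℕ → List (ℕ × ℕ)
localCells p t = map (rotN (boxSize p) t) (baseCells p)

module Play (d : Dims) where
  infix 4 _≈_

  _≈_ : Board → Board → Set
  b₁ ≈ b₂ = ∀ r c → 1 ≤ r → r ≤ rows d → 1 ≤ c → c ≤ cols d → b₁ r c ≡ b₂ r c

  ≈-trans : ∀ {b₁ b₂ b₃} → b₁ ≈ b₂ → b₂ ≈ b₃ → b₁ ≈ b₃
  ≈-trans e f r c p1 p2 p3 p4 = trans (e r c p1 p2 p3 p4) (f r c p1 p2 p3 p4)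

  ≈-sym : ∀ {b₁ b₂} → b₁ ≈ b₂ → b₂ ≈ b₁
  ≈-sym e r c p1 p2 p3 p4 = sym (e r c p1 p2 p3 p4)

  isOpen-resp : ∀ {b₁ b₂} → b₁ ≈ b₂ → ∀ r c → isOpen d b₁ r c ≡ isOpen d b₂ r c
  isOpen-resp {b₁} {b₂} eq (+ r) (+ c)
    with 1 ≤ᵇ r in e₁ | r ≤ᵇ rows d in e₂ | 1 ≤ᵇ c in e₃ | c ≤ᵇ cols d in e₄
  ... | true | true | true | true = cong not (eq r c (≤ᵇ-true⇒≤ e₁) (≤ᵇ-true⇒≤ e₂) (≤ᵇ-true⇒≤ e₃) (≤ᵇ-true⇒≤ e₄))
  ... | false | _ | _ | _ = refl
  ... | true | false | _ | _ = refl
  ... | true | true | false | _ = refl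
  ... | true | true | true | false = refl
  isOpen-resp eq (+ r) -[1+ c ] = refl
  isOpen-resp eq -[1+ r ] c = refl

  isOpen-true : ∀ {b r c} → 1 ≤ r → r ≤ rows d → 1 ≤ c → c ≤ cols d → b r c ≡ false → isOpen d b (+ r) (+ c) ≡ true
  isOpen-true p1 p2 p3 p4 e rewrite ≤ᵇ-true p1 | ≤ᵇ-true p2 | ≤ᵇ-true p3 | ≤ᵇ-true p4 | e = refl

  isOpen-false : ∀ {b r c} → b r c ≡ true → isOpen d b (+ r) (+ c) ≡ false
  isOpen-false {b} {r} {c} e rewrite e | ∧-zeroʳ (c ≤ᵇ cols d) | ∧-zeroʳ (1 ≤ᵇ c) | ∧-zeroʳ (r ≤ᵇ rows d) = ∧-zeroʳ (1 ≤ᵇ r)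

  fits-resp : ∀ {b₁ b₂} → b₁ ≈ b₂ → ∀ a → fits d b₁ a ≡ fits d b₂ a
  fits-resp eq a = all-cong (λ { (r , c) → isOpen-resp eq r c }) (cellsOf a)

  reach-resp : ∀ {b₁ b₂ a a'} → b₁ ≈ b₂ → Reach d b₁ a a' → Reach d b₂ a a'
  reach-resp eq here = here
  reach-resp eq (step {a} mv f r) = step mv (trans (sym (fits-resp eq (applyMove mv a))) f) (reach-resp eq r)

  reach-trans : ∀ {b a₁ a₂ a₃} → Reach d b a₁ a₂ → Reach d b a₂ a₃ → Reach d b a₁ a₃
  reach-trans here q = q
  reach-trans (step mv f r) q = step mv f (reach-trans r q)

  place-resp : ∀ {b₁ b₂} → b₁ ≈ b₂ → ∀ a → place b₁ a ≈ place b₂ a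
  place-resp eq a r c p1 p2 p3 p4 = cong (_∨ any (λ { (r' , c') → eqℤ r' (+ r) ∧ eqℤ c' (+ c) }) (cellsOf a)) (eq r c p1 p2 p3 p4)

  fullRow-resp : ∀ {b₁ b₂} → b₁ ≈ b₂ → ∀ h → 1 ≤ h → h ≤ rows d → fullRow d b₁ h ≡ fullRow d b₂ h
  fullRow-resp {b₁} {b₂} eq h p1 p2 = all-congᴬ (λ c → b₁ h c) (λ c → b₂ h c)
    (All.map (λ { (q1 , q2) → eq h _ p1 p2 q1 q2 }) (All-oneTo (cols d)))

  cellOfRow : Board → ℕ → Maybe ℕ → Bool
  cellOfRow b c (just h) = b h c
  cellOfRow b c nothing = false

  keptRows : Board → List ℕ
  keptRows b = filterᵇ (λ h → not (fullRow d b h)) (oneTo (rows d))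

  clearRows-suc : ∀ b r c → clearRows d b (suc r) c ≡ cellOfRow b c (nth (keptRows b) r)
  clearRows-suc b r c with nth (filterᵇ (λ h → not (fullRow d b h)) (oneTo (rows d))) r
  ... | just h = refl
  ... | nothing = refl

  clear-resp : ∀ {b₁ b₂} → b₁ ≈ b₂ → clearRows d b₁ ≈ clearRows d b₂
  clear-resp {b₁} {b₂} eq (suc r) c p1 p2 p3 p4
    rewrite clearRows-suc b₁ r c | clearRows-suc b₂ r c
          | filterᵇ-cong (λ h → not (fullRow d b₁ h)) (λ h → not (fullRow d b₂ h))
              (All.map (λ { (q1 , q2) → cong not (fullRow-resp eq _ q1 q2) }) (All-oneTo (rows d)))
    with nth (keptRows b₂) r in e
  ... | nothing = refl
  ... | just h with nth-All r (filter⁺ (T? ∘ (λ h → not (fullRow d b₂ h))) (All-oneTo (rows d))) e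
  ... | q1 , q2 = eq h c q1 q2 p3 p4

  settle-resp : ∀ {b₁ b₂} → b₁ ≈ b₂ → ∀ a → settle d b₁ a ≈ settle d b₂ a
  settle-resp eq a = clear-resp (place-resp eq a)

  Win : Board → List Piece → Set
  Win b ps = Σ Board (λ b' → Game d b ps b' × EmptyBoard d b')

  game-resp : ∀ {b₁ b₂ ps b'} → b₁ ≈ b₂ → Game d b₁ ps b' → Σ Board (λ b'' → Game d b₂ ps b'' × b' ≈ b'')
  game-resp eq finish = _ , finish , eq
  game-resp eq (turn {p = p} a f r nf g) with game-resp (settle-resp eq a) g
  ... | b'' , g' , e' = b'' , turn a (trans (sym (fits-resp eq (spawn d p))) f) (reach-resp eq r) (trans (sym (fits-resp eq (applyMove drop a))) nf) g' , e'

  win-resp : ∀ {b₁ b₂ ps} → b₁ ≈ b₂ → Win b₁ ps → Win b₂ ps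
  win-resp eq (b' , g , em) with game-resp eq g
  ... | b'' , g' , e' = b'' , g' , λ r c p1 p2 p3 p4 → trans (sym (e' r c p1 p2 p3 p4)) (em r c p1 p2 p3 p4)

  win-turn : ∀ {b p ps} a → fits d b (spawn d p) ≡ true → Reach d b (spawn d p) a →
             fits d b (applyMove drop a) ≡ false → Win (settle d b a) ps → Win b (p ∷ ps)
  win-turn a f r nf (b' , g , em) = b' , turn a f r nf g , em

  win-finish : ∀ {b} → EmptyBoard d b → Win b []
  win-finish e = _ , finish , e

  module ClearBand (b : Board) (Lo m q : ℕ) (eqR : Lo + (m + q) ≡ rows d)
    (h1 : ∀ h → 1 ≤ h → h ≤ Lo → fullRow d b h ≡ false)
    (h2 : ∀ h → Lo < h → h ≤ Lo + m → fullRow d b h ≡ true)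
    (h3 : ∀ h → Lo + m < h → h ≤ rows d → fullRow d b h ≡ false) where
    P : ℕ → Bool
    P h = not (fullRow d b h)
    eqR' : Lo + m + q ≡ rows d
    eqR' = trans (+-assoc Lo m q) eqR
    f1 : filterᵇ P (upFrom 1 Lo) ≡ upFrom 1 Lo
    f1 = filterᵇ-all P (All.map (λ { (p , s≤s q') → cong not (h1 _ p q') }) (All-upFrom 1 Lo))
    f2 : filterᵇ P (upFrom (suc Lo) m) ≡ []
    f2 = filterᵇ-none P (All.map (λ { (p , s≤s q') → cong not (h2 _ p q') }) (All-upFrom (suc Lo) m))
    f3 : filterᵇ P (upFrom (suc (Lo + m)) q) ≡ upFrom (suc (Lo + m)) q
    f3 = filterᵇ-all P (All.map (λ { (p , s≤s q') → cong not (h3 _ p (subst (_ ≤_) eqR' q')) }) (All-upFrom (suc (Lo + m)) q))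
    keptRows≡ : keptRows b ≡ upFrom 1 Lo ++ upFrom (suc (Lo + m)) q
    keptRows≡ = begin
      filterᵇ P (oneTo (rows d)) ≡⟨ cong (filterᵇ P) (trans (oneTo≡upFrom (rows d)) (cong (upFrom 1) (sym eqR))) ⟩
      filterᵇ P (upFrom 1 (Lo + (m + q))) ≡⟨ cong (filterᵇ P) (upFrom-++ 1 Lo (m + q)) ⟩
      filterᵇ P (upFrom 1 Lo ++ upFrom (suc Lo) (m + q)) ≡⟨ filter-++ (T? ∘ P) (upFrom 1 Lo) _ ⟩
      filterᵇ P (upFrom 1 Lo) ++ filterᵇ P (upFrom (suc Lo) (m + q))
        ≡⟨ cong₂ _++_ f1 (trans (cong (filterᵇ P) (upFrom-++ (suc Lo) m q)) (trans (filter-++ (T? ∘ P) (upFrom (suc Lo) m) _) (cong₂ _++_ f2 f3))) ⟩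
      upFrom 1 Lo ++ upFrom (suc (Lo + m)) q ∎
      where open ≡-Reasoning

    clear-low : ∀ r c → r < Lo → clearRows d b (suc r) c ≡ b (suc r) c
    clear-low r c p rewrite clearRows-suc b r c | keptRows≡
      | nth-++ˡ (upFrom 1 Lo) (upFrom (suc (Lo + m)) q) r (subst (r <_) (sym (length-upFrom 1 Lo)) p)
      | nth-upFrom 1 Lo r p = refl

    clear-mid : ∀ r c → Lo ≤ r → r < Lo + q → clearRows d b (suc r) c ≡ b (suc (r + m)) c
    clear-mid r c p1 p2 rewrite clearRows-suc b r c | keptRows≡
      | nth-++ʳ (upFrom 1 Lo) (upFrom (suc (Lo + m)) q) r (subst (_≤ r) (sym (length-upFrom 1 Lo)) p1)
      | length-upFrom 1 Lo
      | nth-upFrom (suc (Lo + m)) q (r ∸ Lo) (+-cancelˡ-< Lo _ _ (subst (_< Lo + q) (sym (m+[n∸m]≡n p1)) p2))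
      = cong (λ z → b z c) (cong suc (trans (+-assoc Lo m (r ∸ Lo)) (trans (cong (λ z → Lo + z) (+-comm m (r ∸ Lo)))
          (trans (sym (+-assoc Lo (r ∸ Lo) m)) (cong (_+ m) (m+[n∸m]≡n p1))))))

    clear-high : ∀ r c → Lo + q ≤ r → clearRows d b (suc r) c ≡ false
    clear-high r c p rewrite clearRows-suc b r c | keptRows≡
      | nth-++ʳ (upFrom 1 Lo) (upFrom (suc (Lo + m)) q) r (subst (_≤ r) (sym (length-upFrom 1 Lo)) (≤-trans (m≤m+n Lo q) p))
      | length-upFrom 1 Lo
      | nth-upFrom-beyond (suc (Lo + m)) q (r ∸ Lo) (+-cancelˡ-≤ Lo _ _ (subst (Lo + q ≤_) (sym (m+[n∸m]≡n (≤-trans (m≤m+n Lo q) p))) p))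
      = refl

  move : ∀ {b a a'} mv → applyMove mv a ≡ a' → fits d b a' ≡ true → Reach d b a a'
  move mv refl f = step mv f here

  slideRight* : ∀ {b} p t y x n → (∀ k → k ≤ n → fits d b (active p t (+ (x + k)) y) ≡ true) →
             Reach d b (active p t (+ x) y) (active p t (+ (x + n)) y)
  slideRight* {b} p t y x zero f = subst (λ z → Reach d b (active p t (+ x) y) (active p t (+ z) y)) (sym (+-identityʳ x)) here
  slideRight* {b} p t y x (suc n) f = reach-trans (slideRight* p t y x n (λ k k≤n → f k (m≤n⇒m≤1+n k≤n)))
    (move slideR (cong (λ z → active p t (+ z) y) (trans (+-assoc x n 1) (cong (λ z → x + z) (+-comm n 1)))) (f (suc n) ≤-refl))

  slideLeft* : ∀ {b} p t y x n → (∀ k → k ≤ n → fits d b (active p t (+ (x + k)) y) ≡ true) →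
             Reach d b (active p t (+ (x + n)) y) (active p t (+ x) y)
  slideLeft* {b} p t y x zero f = subst (λ z → Reach d b (active p t (+ z) y) (active p t (+ x) y)) (sym (+-identityʳ x)) here
  slideLeft* {b} p t y x (suc n) f = reach-trans
    (move slideL (cong (λ z → applyMove slideL (active p t (+ z) y)) (+-suc x n)) (f n (n≤1+n n)))
    (slideLeft* p t y x n (λ k k≤n → f k (m≤n⇒m≤1+n k≤n)))

  dropDown* : ∀ {b} p t x y n → (∀ k → k ≤ n → fits d b (active p t x (+ (y + k))) ≡ true) →
             Reach d b (active p t x (+ (y + n))) (active p t x (+ y))
  dropDown* {b} p t x y zero f = subst (λ z → Reach d b (active p t x (+ z)) (active p t x (+ y))) (sym (+-identityʳ y)) here
  dropDown* {b} p t x y (suc n) f = reach-trans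
    (move drop (cong (λ z → applyMove drop (active p t x (+ z))) (+-suc y n)) (f n (n≤1+n n)))
    (dropDown* p t x y n (λ k k≤n → f k (m≤n⇒m≤1+n k≤n)))

  rotateRight* : ∀ {b} p x y n → (∀ t → t ≤ n → fits d b (active p t x y) ≡ true) → Reach d b (active p 0 x y) (active p n x y)
  rotateRight* p x y zero f = here
  rotateRight* p x y (suc n) f = reach-trans (rotateRight* p x y n (λ t t≤ → f t (m≤n⇒m≤1+n t≤))) (move rotR refl (f (suc n) ≤-refl))

  dyP : ℕ → ℕ × ℕ → Bool
  dyP m (dx , dy) = dy <ᵇ m

  place-elsewhere : ∀ b p t x y h c m → all (dyP m) (localCells p t) ≡ true → (h < y ⊎ y + m ≤ h) →
     place b (active p t (+ x) (+ y)) h c ≡ b h c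
  place-elsewhere b p t x y h c m chk hy = trans (cong (b h c ∨_) (trans (any-map _ _ (localCells p t))
      (any≡false _ (All.map (λ {e} → aux e) (all≡true⇒All (dyP m) (localCells p t) chk))))) (∨-identityʳ _)
    where
    aux : ∀ e → dyP m e ≡ true → (y + proj₂ e ≡ᵇ h) ∧ (x + proj₁ e ≡ᵇ c) ≡ false
    aux (dx , dy) q = ∧-falseˡ _ (≡ᵇ-false ne)
      where ne' : (h < y ⊎ y + m ≤ h) → y + dy ≢ h
            ne' (inj₁ p) e = <⇒≱ p (subst (y ≤_) e (m≤m+n y dy))
            ne' (inj₂ p) e = <⇒≱ (+-monoʳ-< y (<ᵇ⇒< dy m (≡true⇒T q))) (subst (y + m ≤_) (sym e) p)
            ne : y + dy ≢ h
            ne = ne' hy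

  slideBetween : ∀ {b} p t y lo hi x₁ x₂ → (∀ z → lo ≤ z → z ≤ hi → fits d b (active p t (+ z) y) ≡ true) →
              lo ≤ x₁ → x₁ ≤ hi → lo ≤ x₂ → x₂ ≤ hi → Reach d b (active p t (+ x₁) y) (active p t (+ x₂) y)
  slideBetween {b} p t y lo hi x₁ x₂ f l1 h1 l2 h2 with ≤-total x₁ x₂
  ... | inj₁ le = subst (λ z → Reach d b (active p t (+ x₁) y) (active p t (+ z) y)) (m+[n∸m]≡n le)
        (slideRight* p t y x₁ (x₂ ∸ x₁) (λ k k≤ → f (x₁ + k) (≤-trans l1 (m≤m+n x₁ k))
           (≤-trans (+-monoʳ-≤ x₁ k≤) (subst (_≤ hi) (sym (m+[n∸m]≡n le)) h2))))
  ... | inj₂ le = subst (λ z → Reach d b (active p t (+ z) y) (active p t (+ x₂) y)) (m+[n∸m]≡n le)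
        (slideLeft* p t y x₂ (x₁ ∸ x₂) (λ k k≤ → f (x₂ + k) (≤-trans l2 (m≤m+n x₂ k))
           (≤-trans (+-monoʳ-≤ x₂ k≤) (subst (_≤ hi) (sym (m+[n∸m]≡n le)) h1))))

  fits-cellwise : ∀ b p t x y (P : ℕ × ℕ → Bool) → all P (localCells p t) ≡ true →
     (∀ dx dy → P (dx , dy) ≡ true → isOpen d b (+ (y + dy)) (+ (x + dx)) ≡ true) →
     fits d b (active p t (+ x) (+ y)) ≡ true
  fits-cellwise b p t x y P e f = trans (all-map _ _ (localCells p t))
     (all≡true _ (All.map (λ {c} → aux c) (all≡true⇒All P (localCells p t) e)))
    where aux : ∀ c → P c ≡ true → isOpen d b (+ (y + proj₂ c)) (+ (x + proj₁ c)) ≡ true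
          aux (dx , dy) q = f dx dy q

  fits-blocked : ∀ b p t x y (P : ℕ × ℕ → Bool) → any P (localCells p t) ≡ true →
     (∀ dx dy → P (dx , dy) ≡ true → isOpen d b (+ (y + dy)) (+ (x + dx)) ≡ false) →
     fits d b (active p t (+ x) (+ y)) ≡ false
  fits-blocked b p t x y P e f = trans (all-map _ _ (localCells p t))
     (all≡false _ (Any.map (λ {c} → aux c) (any≡true⇒Any P (localCells p t) e)))
    where aux : ∀ c → P c ≡ true → isOpen d b (+ (y + proj₂ c)) (+ (x + proj₁ c)) ≡ false
          aux (dx , dy) q = f dx dy q

-- Column heights are measured from a base level w and stay below relHeightBound,
-- so the effect of a piece on a column is a closed boolean computation: each
-- concrete placement in the construction is checked by refl.
relHeightBound : ℕ
relHeightBound = 14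

hitsRel : ℕ → ℕ → ℕ → ℕ × ℕ → Bool
hitsRel b k t (dx , dy) = (dx ≡ᵇ k) ∧ (b + dy ≡ᵇ t)

belowBound : ℕ → ℕ × ℕ → Bool
belowBound b (dx , dy) = b + dy <ᵇ relHeightBound

anyHitsRel : List (ℕ × ℕ) → ℕ → ℕ → ℕ → Bool
anyHitsRel L b k t = any (hitsRel b k t) L

columnUpdateAt : List (ℕ × ℕ) → ℕ → ℕ → ℕ → ℕ → ℕ → Bool
columnUpdateAt L b gk gk' k t = sameBool ((t ≤ᵇ gk) ∨ anyHitsRel L b k t) (t ≤ᵇ gk')

columnUpdateCheck : List (ℕ × ℕ) → ℕ → ℕ → ℕ → ℕ → Bool
columnUpdateCheck L b gk gk' k = allUpTo relHeightBound (columnUpdateAt L b gk gk' k)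
  ∧ ((gk <ᵇ relHeightBound) ∧ ((gk' <ᵇ relHeightBound) ∧ all (belowBound b) L))

columnUpdate-rel : ∀ L b gk gk' k → columnUpdateCheck L b gk gk' k ≡ true → ∀ t → (t ≤ᵇ gk) ∨ anyHitsRel L b k t ≡ (t ≤ᵇ gk')
columnUpdate-rel L b gk gk' k e t with ∧-true⁻ {allUpTo relHeightBound (columnUpdateAt L b gk gk' k)} e
... | e1 , e2 with ∧-true⁻ {gk <ᵇ relHeightBound} e2
... | e3 , 4[1+n]≡4+4n with ∧-true⁻ {gk' <ᵇ relHeightBound} 4[1+n]≡4+4n
... | e5 , e6 with t ≤? relHeightBound
... | yes p = sameBool⇒≡ _ _ (allUpTo⇒ relHeightBound (columnUpdateAt L b gk gk' k) t e1 p)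
... | no np = trans (trans (∨-falseˡ _ (≤ᵇ-false (<-trans (<ᵇ⇒< gk relHeightBound (≡true⇒T e3)) (≰⇒> np))))
                    (any≡false (hitsRel b k t) (All.map (λ {x} → aux x) (all≡true⇒All (belowBound b) L e6))))
               (sym (≤ᵇ-false (<-trans (<ᵇ⇒< gk' relHeightBound (≡true⇒T e5)) (≰⇒> np))))
  where
  aux : ∀ x → belowBound b x ≡ true → hitsRel b k t x ≡ false
  aux (dx , dy) q = trans (cong ((dx ≡ᵇ k) ∧_) (≡ᵇ-false (λ eq → <⇒≢ (<-trans (<ᵇ⇒< (b + dy) relHeightBound (≡true⇒T q)) (≰⇒> np)) eq))) (∧-zeroʳ _)

columnUpdate : ∀ L b gk gk' k → columnUpdateCheck L b gk gk' k ≡ true → ∀ w r →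
  (r ≤ᵇ w + gk) ∨ any (hitsRel (w + b) k r) L ≡ (r ≤ᵇ w + gk')
columnUpdate L b gk gk' k e w r with r ≤? w
... | yes p = trans (∨-trueˡ _ (≤ᵇ-true (≤-trans p (m≤m+n w gk)))) (sym (≤ᵇ-true (≤-trans p (m≤m+n w gk'))))
... | no np = begin
    (r ≤ᵇ w + gk) ∨ any _ L
      ≡⟨ cong₂ _∨_ (trans (cong (_≤ᵇ w + gk) (sym r≡)) (≤ᵇ-cancelˡ w (r ∸ w) gk))
                   (any-cong (λ { (dx , dy) → cong ((dx ≡ᵇ k) ∧_) (trans (cong₂ _≡ᵇ_ (+-assoc w b dy) (sym r≡)) (≡ᵇ-cancelˡ w (b + dy) (r ∸ w))) }) L) ⟩
    (r ∸ w ≤ᵇ gk) ∨ anyHitsRel L b k (r ∸ w) ≡⟨ columnUpdate-rel L b gk gk' k e (r ∸ w) ⟩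
    (r ∸ w ≤ᵇ gk') ≡⟨ sym (trans (cong (_≤ᵇ w + gk') (sym r≡)) (≤ᵇ-cancelˡ w (r ∸ w) gk')) ⟩
    (r ≤ᵇ w + gk') ∎
  where open ≡-Reasoning
        r≡ : w + (r ∸ w) ≡ r
        r≡ = m+[n∸m]≡n (<⇒≤ (≰⇒> np))

Profile : Set
Profile = ℕ → ℕ → ℕ

colOf : ℕ → ℕ → ℕ
colOf j k = 6 * j + 1 + k

colOf≡ : ∀ j k → colOf j k ≡ suc (k + j * 6)
colOf≡ = ring
  where ring : ∀ j k → 6 * j + 1 + k ≡ 1 + (k + j * 6)
        ring = solve-∀

colOf∸1 : ∀ j k → colOf j k ∸ 1 ≡ k + j * 6
colOf∸1 j k = cong (_∸ 1) (colOf≡ j k)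

colOf-mod : ∀ j k → k < 6 → (colOf j k ∸ 1) % 6 ≡ k
colOf-mod j k p = trans (cong (_% 6) (colOf∸1 j k)) (trans ([m+kn]%n≡m%n k j 6) (m<n⇒m%n≡m p))

colOf-div : ∀ j k → k < 6 → (colOf j k ∸ 1) / 6 ≡ j
colOf-div j k p = trans (cong (_/ 6) (colOf∸1 j k)) (trans (+-distrib-/ k (j * 6) lt) (cong₂ _+_ (m<n⇒m/n≡0 p) (m*n/n≡m j 6)))
  where lt : k % 6 + (j * 6) % 6 < 6
        lt = subst (_< 6) (sym (trans (cong₂ _+_ (m<n⇒m%n≡m p) (m*n%n≡0 j 6)) (+-identityʳ k))) p

colOf-+ : ∀ j e dx → colOf j e + dx ≡ colOf j (e + dx)
colOf-+ j e dx = +-assoc (6 * j + 1) e dx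

colOf-injective : ∀ {j j' k k'} → k < 6 → k' < 6 → colOf j k ≡ colOf j' k' → j ≡ j' × k ≡ k'
colOf-injective {j} {j'} {k} {k'} p p' e =
  trans (sym (colOf-div j k p)) (trans (cong (λ z → (z ∸ 1) / 6) e) (colOf-div j' k' p')) ,
  trans (sym (colOf-mod j k p)) (trans (cong (λ z → (z ∸ 1) % 6) e) (colOf-mod j' k' p'))

colOf≤6+6j : ∀ j k → k < 6 → colOf j k ≤ 6 * suc j
colOf≤6+6j j k p = ≤-trans (≤-reflexive (colOf≡ j k)) (subst (suc (k + j * 6) ≤_) (ring j) (+-monoˡ-≤ (j * 6) p))
  where ring : ∀ j → 6 + j * 6 ≡ 6 * suc j
        ring = solve-∀

6j<colOf : ∀ j k → 6 * j < colOf j k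
6j<colOf j k = subst (6 * j <_) (sym (+-assoc (6 * j) 1 k)) (subst (6 * j <_) (sym (+-suc (6 * j) k)) (s≤s (m≤m+n (6 * j) k)))

colOf-view : ∀ s c → 1 ≤ c → c ≤ 6 * s → Σ ℕ λ j → Σ ℕ λ k → j < s × k < 6 × c ≡ colOf j k
colOf-view s (suc c') _ le = c' / 6 , c' % 6 , jlt , m%n<n c' 6 , ceq
  where
  ceq : suc c' ≡ colOf (c' / 6) (c' % 6)
  ceq = trans (cong suc (m≡m%n+[m/n]*n c' 6)) (sym (colOf≡ (c' / 6) (c' % 6)))

  jlt : c' / 6 < s
  jlt = m<n*o⇒m/o<n (subst (c' <_) (*-comm 6 s) le)

load : ∀ {n} → (Fin n → ℕ) → (Fin n → ℕ) → List (Fin n) → ℕ → ℕ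
load bk a [] j = 0
load bk a (i ∷ is) j = (if bk i ≡ᵇ j then suc (a i) else 0) + load bk a is j

load-tabulate : ∀ {n m} (g : Fin n → Fin m) (bk a : Fin m → ℕ) j →
  load bk a (L.tabulate g) j ≡ V.sum (V.tabulate (λ i → if bk (g i) ≡ᵇ j then suc (a (g i)) else 0))
load-tabulate {zero} g bk a j = refl
load-tabulate {suc n} g bk a j = cong (λ z → (if bk (g F.zero) ≡ᵇ j then suc (a (g F.zero)) else 0) + z)
  (load-tabulate (λ i → g (F.suc i)) bk a j)

count-step : ∀ b x C S → (if b then suc x else 0) + (C + S) ≡ (if does (b B.≟ true) then suc else (λ z → z)) C + ((if b then x else 0) + S)
count-step true x C S = cong suc (ring x C S) where
  ring : ∀ x C S → x + (C + S) ≡ C + (x + S)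
  ring = solve-∀
count-step false x C S = refl

count-split : ∀ n (P : Fin n → Bool) (a : Fin n → ℕ) →
  V.sum (V.tabulate (λ i → if P i then suc (a i) else 0)) ≡ ∣ V.tabulate P ∣ + subsetSum a (V.tabulate P)
count-split zero P a = refl
count-split (suc n) P a = trans (cong (λ z → (if P F.zero then suc (a F.zero) else 0) + z) (count-split n (λ i → P (F.suc i)) (λ i → a (F.suc i))))
  (count-step (P F.zero) (a F.zero) _ _)

toℕ-≡ᵇ : ∀ {m} (x y : Fin m) → (F.toℕ x ≡ᵇ F.toℕ y) ≡ does (x FP.≟ y)
toℕ-≡ᵇ F.zero F.zero = refl
toℕ-≡ᵇ F.zero (F.suc y) = refl
toℕ-≡ᵇ (F.suc x) F.zero = refl
toℕ-≡ᵇ (F.suc x) (F.suc y) = toℕ-≡ᵇ x y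

preimage : ∀ {n m} → (Fin n → Fin m) → Fin m → Subset n
preimage f j = V.tabulate (λ i → does (f i FP.≟ j))

load-allFin : ∀ {n m} (f : Fin n → Fin m) (a : Fin n → ℕ) (j : Fin m) →
  load (F.toℕ ∘ f) a (L.allFin n) (F.toℕ j) ≡ ∣ preimage f j ∣ + subsetSum a (preimage f j)
load-allFin {n} f a j = begin
  load (F.toℕ ∘ f) a (L.allFin n) (F.toℕ j)
    ≡⟨ load-tabulate (λ i → i) (F.toℕ ∘ f) a (F.toℕ j) ⟩
  V.sum (V.tabulate (λ i → if F.toℕ (f i) ≡ᵇ F.toℕ j then suc (a i) else 0))
    ≡⟨ cong V.sum (VP.tabulate-cong (λ i → cong (λ b → if b then suc (a i) else 0) (toℕ-≡ᵇ (f i) j))) ⟩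
  V.sum (V.tabulate (λ i → if does (f i FP.≟ j) then suc (a i) else 0))
    ≡⟨ count-split n (λ i → does (f i FP.≟ j)) a ⟩
  ∣ preimage f j ∣ + subsetSum a (preimage f j) ∎
  where open ≡-Reasoning

module Construction (s T : ℕ) (s≥1 : 1 ≤ s) where
  d : Dims
  d = gameDims s T
  open Play d public

  H Q : ℕ
  H = 6 * T + 22
  Q = 6 * T + 22 + 3 * s

  notchCell : ℕ → ℕ → Bool
  notchCell v h = (h ≤ᵇ H) ∧ (not (h % 6 ≡ᵇ 5) ∨ (h <ᵇ 6 * v))

  bucketCell : ℕ → ℕ → ℕ → Bool
  bucketCell 0 v h = h ≤ᵇ v
  bucketCell 1 v h = h ≤ᵇ v
  bucketCell 2 v h = h ≤ᵇ v
  bucketCell 3 v h = notchCell v h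
  bucketCell 4 v h = notchCell v h
  bucketCell _ v h = h ≤ᵇ H

  lockCell : ℕ → ℕ → Bool
  lockCell h c = (h ≤ᵇ H) ∧ (if c ≡ᵇ 6 * s + 1 then h ≤ᵇ 6 * T + 20
                         else if c ≡ᵇ 6 * s + 2 then h ≤ᵇ 6 * T + 21
                         else if c ≡ᵇ 6 * s + 3 then h ≡ᵇ 6 * T + 21 else false)

  profileBoard : Profile → Board
  profileBoard G h c = if c ≤ᵇ 6 * s then bucketCell ((c ∸ 1) % 6) (G ((c ∸ 1) / 6) ((c ∸ 1) % 6)) h else lockCell h c

  colOf≤6s : ∀ j k → j < s → k < 6 → colOf j k ≤ 6 * s
  colOf≤6s j k p q = ≤-trans (colOf≤6+6j j k q) (*-monoʳ-≤ 6 p)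

  profileBoard-bucket : ∀ G j k h → j < s → k < 6 → profileBoard G h (colOf j k) ≡ bucketCell k (G j k) h
  profileBoard-bucket G j k h p q = trans (if-true (≤ᵇ-true (colOf≤6s j k p q))) (cong₂ (λ a b → bucketCell a (G b a) h) (colOf-mod j k q) (colOf-div j k q))

  profileBoard-lock : ∀ G h c → 6 * s < c → profileBoard G h c ≡ lockCell h c
  profileBoard-lock G h c p = if-false (≤ᵇ-false p)

  Bounded : Profile → Set
  Bounded G = ∀ j k → j < s → k < 3 → G j k ≤ H

  Agree : Profile → Profile → Set
  Agree G G' = ∀ j k → j < s → k < 5 → G j k ≡ G' j k

  bucketCell-aboveH : ∀ k v h → (k < 3 → v ≤ H) → H < h → bucketCell k v h ≡ false
  bucketCell-aboveH 0 v h b p = ≤ᵇ-false (≤-<-trans (b (s≤s z≤n)) p)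
  bucketCell-aboveH 1 v h b p = ≤ᵇ-false (≤-<-trans (b (s≤s (s≤s z≤n))) p)
  bucketCell-aboveH 2 v h b p = ≤ᵇ-false (≤-<-trans (b (s≤s (s≤s (s≤s z≤n)))) p)
  bucketCell-aboveH 3 v h b p = ∧-falseˡ _ (≤ᵇ-false p)
  bucketCell-aboveH 4 v h b p = ∧-falseˡ _ (≤ᵇ-false p)
  bucketCell-aboveH (suc (suc (suc (suc (suc k))))) v h b p = ≤ᵇ-false p

  profileBoard-aboveH : ∀ G → Bounded G → ∀ h c → H < h → 1 ≤ c → profileBoard G h c ≡ false
  profileBoard-aboveH G bnd h c p p3 with c ≤? 6 * s
  ... | no gt = trans (profileBoard-lock G h c (≰⇒> gt)) (∧-falseˡ _ (≤ᵇ-false p))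
  ... | yes le with colOf-view s c p3 le
  ...   | j , k , pj , pk , refl = trans (profileBoard-bucket G j k h pj pk) (bucketCell-aboveH k (G j k) h (bnd j k pj) p)

  spawnX spawnY : Piece → ℕ
  spawnX p = suc ⌊ (6 * s + 3) ∸ boxSize p /2⌋
  spawnY p = Q + (5 ∸ boxSize p)

  spawnRow : ∀ k → k ≤ 5 → suc (Q + 4) ℤ.⊖ k ≡ + (Q + (5 ∸ k))
  spawnRow k p = trans (⊖-≥ (≤-trans p (≤-trans (m≤n+m 5 Q) (≤-reflexive (+-suc Q 4)))))
    (cong +_ (trans (cong (_∸ k) (sym (+-suc Q 4))) (+-∸-assoc Q p)))

  spawn≡ : ∀ p → spawn d p ≡ active p 0 (+ spawnX p) (+ spawnY p)
  spawn≡ Sq = cong (active Sq 0 (+ spawnX Sq)) (spawnRow 2 (s≤s (s≤s z≤n)))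
  spawn≡ LG = cong (active LG 0 (+ spawnX LG)) (spawnRow 3 (s≤s (s≤s (s≤s z≤n))))
  spawn≡ RG = cong (active RG 0 (+ spawnX RG)) (spawnRow 3 (s≤s (s≤s (s≤s z≤n))))
  spawn≡ LS = cong (active LS 0 (+ spawnX LS)) (spawnRow 3 (s≤s (s≤s (s≤s z≤n))))
  spawn≡ RS = cong (active RS 0 (+ spawnX RS)) (spawnRow 3 (s≤s (s≤s (s≤s z≤n))))
  spawn≡ I = cong (active I 0 (+ spawnX I)) (spawnRow 4 (s≤s (s≤s (s≤s (s≤s z≤n)))))
  spawn≡ Tee = cong (active Tee 0 (+ spawnX Tee)) (spawnRow 3 (s≤s (s≤s (s≤s z≤n))))

  boxSize≤4 : ∀ p → boxSize p ≤ 4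
  boxSize≤4 Sq = s≤s (s≤s z≤n)
  boxSize≤4 LG = s≤s (s≤s (s≤s z≤n))
  boxSize≤4 RG = s≤s (s≤s (s≤s z≤n))
  boxSize≤4 LS = s≤s (s≤s (s≤s z≤n))
  boxSize≤4 RS = s≤s (s≤s (s≤s z≤n))
  boxSize≤4 I = s≤s (s≤s (s≤s (s≤s z≤n)))
  boxSize≤4 Tee = s≤s (s≤s (s≤s z≤n))

  4≤cols : 4 ≤ 6 * s + 3
  4≤cols = ≤-trans (s≤s (s≤s (s≤s (s≤s z≤n)))) (+-monoˡ-≤ 3 (*-monoʳ-≤ 6 s≥1))

  spawnX-inside : ∀ p → spawnX p + boxSize p ≤ suc (cols d)
  spawnX-inside p = s≤s (≤-trans (+-monoˡ-≤ (boxSize p) (⌊n/2⌋≤n ((6 * s + 3) ∸ boxSize p)))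
                  (≤-reflexive (m∸n+n≡m (≤-trans (boxSize≤4 p) 4≤cols))))

  H≤Q : H ≤ Q
  H≤Q = m≤m+n H (3 * s)

  H<spawnY : ∀ p → H < spawnY p
  H<spawnY p = ≤-trans (s≤s H≤Q) (≤-trans (≤-reflexive (+-comm 1 Q)) (+-monoʳ-≤ Q (≤-trans (s≤s z≤n) (∸-monoʳ-≤ 5 (boxSize≤4 p)))))

  spawnY-inside : ∀ p → spawnY p + boxSize p ≤ suc (rows d)
  spawnY-inside p = ≤-reflexive (trans (+-assoc Q (5 ∸ boxSize p) (boxSize p))
      (trans (cong (λ z → Q + z) (m∸n+n≡m (≤-trans (boxSize≤4 p) (n≤1+n 4)))) (+-suc Q 4)))

  EmptyAboveH : Board → Set
  EmptyAboveH b = ∀ h c → H < h → 1 ≤ c → b h c ≡ false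

  inRect : ℕ → ℕ → ℕ × ℕ → Bool
  inRect wd ht (dx , dy) = (dx <ᵇ wd) ∧ (dy <ᵇ ht)

  allInBox : Piece → ℕ → Bool
  allInBox p t = all (inRect (boxSize p) (boxSize p)) (localCells p t)

  fits-aboveH : ∀ b p t x y wd → EmptyAboveH b → all (inRect wd (boxSize p)) (localCells p t) ≡ true → 1 ≤ x → x + wd ≤ suc (cols d) → H < y →
            y + boxSize p ≤ suc (rows d) → fits d b (active p t (+ x) (+ y)) ≡ true
  fits-aboveH b p t x y wd te bok px1 px2 py1 py2 = fits-cellwise b p t x y (inRect wd (boxSize p)) bok cell
    where
    cell : ∀ dx dy → inRect wd (boxSize p) (dx , dy) ≡ true → isOpen d b (+ (y + dy)) (+ (x + dx)) ≡ true
    cell dx dy q with ∧-true⁻ {dx <ᵇ wd} q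
    ... | q1 , q2 = isOpen-true {b} {y + dy} {x + dx} (≤-trans (s≤s z≤n) (≤-trans py1 (m≤m+n y dy)))
        (≤-pred (≤-trans (+-monoʳ-< y (<ᵇ⇒< dy _ (≡true⇒T q2))) py2))
        (≤-trans px1 (m≤m+n x dx))
        (≤-pred (≤-trans (+-monoʳ-< x (<ᵇ⇒< dx _ (≡true⇒T q1))) px2))
        (te (y + dy) (x + dx) (≤-trans py1 (m≤m+n y dy)) (≤-trans px1 (m≤m+n x dx)))

  enterAndAlign : ∀ b p t X wd → EmptyAboveH b → allUpTo t (allInBox p) ≡ true →
     all (inRect wd (boxSize p)) (localCells p t) ≡ true → wd ≤ boxSize p → 1 ≤ X → X + wd ≤ suc (cols d) →
     fits d b (spawn d p) ≡ true × Reach d b (spawn d p) (active p t (+ X) (+ spawnY p))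
  enterAndAlign b p t X wd te bok wok wdk pX1 pX2 = subst (λ a → fits d b a ≡ true × Reach d b a (active p t (+ X) (+ spawnY p))) (sym (spawn≡ p)) (
    fits-aboveH b p 0 (spawnX p) (spawnY p) (boxSize p) te (allUpTo⇒ t (allInBox p) 0 bok z≤n) (s≤s z≤n) (spawnX-inside p) (H<spawnY p) (spawnY-inside p) ,
    reach-trans (rotateRight* p (+ spawnX p) (+ spawnY p) t (λ t' t'≤ → fits-aboveH b p t' (spawnX p) (spawnY p) (boxSize p) te (allUpTo⇒ t (allInBox p) t' bok t'≤) (s≤s z≤n) (spawnX-inside p) (H<spawnY p) (spawnY-inside p)))
      (slideBetween p t (+ spawnY p) 1 (suc (cols d) ∸ wd) (spawnX p) X
        (λ z p1 p2 → fits-aboveH b p t z (spawnY p) wd te wok p1 (sl p2) (H<spawnY p) (spawnY-inside p))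
        (s≤s z≤n) (sl' (≤-trans (+-monoʳ-≤ (spawnX p) wdk) (spawnX-inside p))) pX1 (sl' pX2)))
    where
    sl : ∀ {z} → z ≤ suc (cols d) ∸ wd → z + wd ≤ suc (cols d)
    sl {z} q = ≤-trans (+-monoˡ-≤ wd q) (≤-reflexive (m∸n+n≡m (≤-trans wdk (≤-trans (boxSize≤4 p) (≤-trans 4≤cols (n≤1+n _))))))
    sl' : ∀ {z} → z + wd ≤ suc (cols d) → z ≤ suc (cols d) ∸ wd
    sl' {z} q = subst (_≤ suc (cols d) ∸ wd) (m+n∸n≡m z wd) (∸-monoˡ-≤ wd q)

  lowCell-false : ∀ k v h → k < 3 → v < h → bucketCell k v h ≡ false
  lowCell-false 0 v h _ p = ≤ᵇ-false p
  lowCell-false 1 v h _ p = ≤ᵇ-false p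
  lowCell-false 2 v h _ p = ≤ᵇ-false p
  lowCell-false (suc (suc (suc k))) v h (s≤s (s≤s (s≤s ()))) p

  lowCell-true : ∀ k v h → k < 3 → h ≤ v → bucketCell k v h ≡ true
  lowCell-true 0 v h _ p = ≤ᵇ-true p
  lowCell-true 1 v h _ p = ≤ᵇ-true p
  lowCell-true 2 v h _ p = ≤ᵇ-true p
  lowCell-true (suc (suc (suc k))) v h (s≤s (s≤s (s≤s ()))) p

  1≤colOf : ∀ j k → 1 ≤ colOf j k
  1≤colOf j k = ≤-trans (s≤s z≤n) (6j<colOf j k)

  colOf≤cols : ∀ j k → j < s → k < 6 → colOf j k ≤ cols d
  colOf≤cols j k p q = ≤-trans (colOf≤6s j k p q) (m≤m+n (6 * s) 3)

  fallsFree : ℕ → (ℕ → ℕ) → ℕ → ℕ → ℕ × ℕ → Bool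
  fallsFree e g b K (dx , dy) = (e + dx <ᵇ 3) ∧ ((g (e + dx) <ᵇ b + dy) ∧ (dy <ᵇ K))

  dropIntoBucket : ∀ G j p t e w b g n → j < s → (∀ k → k < 3 → G j k ≡ w + g k) →
     all (fallsFree e g b (boxSize p)) (localCells p t) ≡ true →
     w + b + n + boxSize p ≤ suc (rows d) →
     Reach d (profileBoard G) (active p t (+ colOf j e) (+ (w + b + n))) (active p t (+ colOf j e) (+ (w + b)))
  dropIntoBucket G j p t e w b g n pj hg chk bnd = dropDown* p t (+ colOf j e) (w + b) n
    (λ k k≤n → fits-cellwise (profileBoard G) p t (colOf j e) (w + b + k) (fallsFree e g b (boxSize p)) chk (cell k k≤n))
    where
    cell : ∀ k → k ≤ n → ∀ dx dy → fallsFree e g b (boxSize p) (dx , dy) ≡ true →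
           isOpen d (profileBoard G) (+ (w + b + k + dy)) (+ (colOf j e + dx)) ≡ true
    cell k k≤n dx dy q with ∧-true⁻ {e + dx <ᵇ 3} q
    ... | q1 , q2 with ∧-true⁻ {g (e + dx) <ᵇ b + dy} q2
    ... | q3 , q4 = subst (λ z → isOpen d (profileBoard G) (+ (w + b + k + dy)) (+ z) ≡ true) (sym (colOf-+ j e dx))
        (isOpen-true {profileBoard G} {w + b + k + dy} {colOf j (e + dx)} (≤-trans (s≤s z≤n) hrow)
          (≤-pred (≤-trans (+-monoʳ-< (w + b + k) (<ᵇ⇒< dy _ (≡true⇒T q4))) (≤-trans (+-monoˡ-≤ (boxSize p) (+-monoʳ-≤ (w + b) k≤n)) bnd)))
          (1≤colOf j (e + dx)) (colOf≤cols j (e + dx) pj kl6)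
          (trans (profileBoard-bucket G j (e + dx) _ pj kl6) (lowCell-false (e + dx) (G j (e + dx)) _ kl3 hrow)))
      where
      kl3 : e + dx < 3
      kl3 = <ᵇ⇒< (e + dx) 3 (≡true⇒T q1)
      kl6 : e + dx < 6
      kl6 = ≤-trans kl3 (s≤s (s≤s (s≤s z≤n)))
      hrow : G j (e + dx) < w + b + k + dy
      hrow = subst (_< w + b + k + dy) (sym (hg (e + dx) kl3))
        (≤-trans (+-monoʳ-< w (<ᵇ⇒< (g (e + dx)) (b + dy) (≡true⇒T q3)))
          (≤-reflexive-le))
        where ≤-reflexive-le : w + (b + dy) ≤ w + b + k + dy
              ≤-reflexive-le = subst (_≤ w + b + k + dy) (+-assoc w b dy) (+-monoˡ-≤ dy (m≤m+n (w + b) k))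

  landsOn : ℕ → (ℕ → ℕ) → ℕ → ℕ × ℕ → Bool
  landsOn e g b' (dx , dy) = (e + dx <ᵇ 3) ∧ (b' + dy ≤ᵇ g (e + dx))

  restsOn : ∀ G j p t e w b' g → j < s → (∀ k → k < 3 → G j k ≡ w + g k) →
     any (landsOn e g b') (localCells p t) ≡ true →
     fits d (profileBoard G) (applyMove drop (active p t (+ colOf j e) (+ (w + suc b')))) ≡ false
  restsOn G j p t e w b' g pj hg chk =
    trans (cong (λ z → fits d (profileBoard G) (applyMove drop (active p t (+ colOf j e) (+ z)))) (+-suc w b'))
      (fits-blocked (profileBoard G) p t (colOf j e) (w + b') (landsOn e g b') chk cell)
    where
    cell : ∀ dx dy → landsOn e g b' (dx , dy) ≡ true → isOpen d (profileBoard G) (+ (w + b' + dy)) (+ (colOf j e + dx)) ≡ false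
    cell dx dy q with ∧-true⁻ {e + dx <ᵇ 3} q
    ... | q1 , q2 = subst (λ z → isOpen d (profileBoard G) (+ (w + b' + dy)) (+ z) ≡ false) (sym (colOf-+ j e dx))
        (isOpen-false {profileBoard G} {w + b' + dy} {colOf j (e + dx)} (trans (profileBoard-bucket G j (e + dx) _ pj kl6) (lowCell-true (e + dx) (G j (e + dx)) _ kl3
          (subst (w + b' + dy ≤_) (sym (hg (e + dx) kl3))
            (subst (_≤ w + g (e + dx)) (sym (+-assoc w b' dy)) (+-monoʳ-≤ w (≤ᵇ-true⇒≤ q2)))))))
      where
      kl3 : e + dx < 3
      kl3 = <ᵇ⇒< (e + dx) 3 (≡true⇒T q1)
      kl6 : e + dx < 6
      kl6 = ≤-trans kl3 (s≤s (s≤s (s≤s z≤n)))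

  lockCol₁ : ∀ h → lockCell h (6 * s + 1) ≡ (h ≤ᵇ H) ∧ (h ≤ᵇ 6 * T + 20)
  lockCol₁ h = cong ((h ≤ᵇ H) ∧_) (if-true (≡ᵇ-refl (6 * s + 1)))

  lockCol₂ : ∀ h → lockCell h (6 * s + 2) ≡ (h ≤ᵇ H) ∧ (h ≤ᵇ 6 * T + 21)
  lockCol₂ h = cong ((h ≤ᵇ H) ∧_) (trans (if-false (≡ᵇ-cancelˡ (6 * s) 2 1)) (if-true (≡ᵇ-refl (6 * s + 2))))

  lockCol₃ : ∀ h → lockCell h (6 * s + 3) ≡ (h ≤ᵇ H) ∧ (h ≡ᵇ 6 * T + 21)
  lockCol₃ h = cong ((h ≤ᵇ H) ∧_) (trans (if-false (≡ᵇ-cancelˡ (6 * s) 3 1)) (trans (if-false (≡ᵇ-cancelˡ (6 * s) 3 2)) (if-true (≡ᵇ-refl (6 * s + 3)))))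

  6s<6s+1+ : ∀ k → 6 * s < 6 * s + suc k
  6s<6s+1+ k = subst (6 * s <_) (sym (+-suc (6 * s) k)) (s≤s (m≤m+n (6 * s) k))

  -- The lock leaves a hole in every row (column 6s+1 in row 6T+21, column 6s+3
  -- elsewhere), so pieces landing in the buckets never clear a row.
  profileBoard-noFullRow : ∀ G h → fullRow d (profileBoard G) h ≡ false
  profileBoard-noFullRow G h with h ≟ 6 * T + 21
  ... | yes refl = all≡false _ (Any-oneTo (cols d) (6 * s + 1) (≤-trans (s≤s z≤n) (6s<6s+1+ 0)) (+-monoʳ-≤ (6 * s) (s≤s z≤n))
          (trans (profileBoard-lock G h (6 * s + 1) (6s<6s+1+ 0)) (trans (lockCol₁ h) (∧-falseʳ (≤ᵇ-cancelˡ (6 * T) 21 20)))))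
  ... | no ne = all≡false _ (Any-oneTo (cols d) (6 * s + 3) (≤-trans (s≤s z≤n) (6s<6s+1+ 2)) ≤-refl
          (trans (profileBoard-lock G h (6 * s + 3) (6s<6s+1+ 2)) (trans (lockCol₃ h) (trans (cong ((h ≤ᵇ H) ∧_) (≡ᵇ-false ne)) (∧-zeroʳ _)))))

  clearRows-noFullRow : ∀ b → (∀ h → 1 ≤ h → h ≤ rows d → fullRow d b h ≡ false) → clearRows d b ≈ b
  clearRows-noFullRow b nf (suc r) c p1 p2 p3 p4 = ClearBand.clear-low b (rows d) 0 0 (+-identityʳ (rows d)) nf
     (λ h p q → ⊥-elim (<⇒≱ p (subst (h ≤_) (+-identityʳ _) q)))
     (λ h p q → ⊥-elim (<⇒≱ (subst (_< h) (+-identityʳ (rows d)) p) q))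
     r c p2

  setBucket : Profile → ℕ → (ℕ → ℕ) → Profile
  setBucket G j g j' k = if j' ≡ᵇ j then g k else G j' k

  setBucket-here : ∀ G j g k → setBucket G j g j k ≡ g k
  setBucket-here G j g k = if-true (≡ᵇ-refl j)

  setBucket-there : ∀ G j g j' k → j' ≢ j → setBucket G j g j' k ≡ G j' k
  setBucket-there G j g j' k ne = if-false (≡ᵇ-false ne)

  hitsCell : ℕ → ℕ → ℕ → ℕ → ℕ × ℕ → Bool
  hitsCell e y k r (dx , dy) = (e + dx ≡ᵇ k) ∧ (y + dy ≡ᵇ r)

  insideBucket : ℕ → ℕ × ℕ → Bool
  insideBucket e (dx , dy) = e + dx <ᵇ 6

  place-inBucket : ∀ G j e p t y (g' : ℕ → ℕ) → j < s →
     all (insideBucket e) (localCells p t) ≡ true →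
     (∀ k → k < 6 → ∀ r → 1 ≤ r → r ≤ rows d → bucketCell k (G j k) r ∨ any (hitsCell e y k r) (localCells p t) ≡ bucketCell k (g' k) r) →
     place (profileBoard G) (active p t (+ colOf j e) (+ y)) ≈ profileBoard (setBucket G j g')
  place-inBucket G j e p t y g' pj chk cond r c p1 p2 p3 p4 =
    trans (cong (profileBoard G r c ∨_) (any-map _ _ (localCells p t))) main
    where
    L = localCells p t
    pt : ℕ × ℕ → Bool
    pt (dx , dy) = (y + dy ≡ᵇ r) ∧ (colOf j e + dx ≡ᵇ c)
    main : profileBoard G r c ∨ any pt L ≡ profileBoard (setBucket G j g') r c
    main with c ≤? 6 * s
    ... | no gt = trans (cong₂ _∨_ (profileBoard-lock G r c (≰⇒> gt)) (any≡false pt (All.map (λ {x} → aux x) (all≡true⇒All (insideBucket e) L chk))))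
                  (trans (∨-identityʳ _) (sym (profileBoard-lock (setBucket G j g') r c (≰⇒> gt))))
      where
      aux : ∀ x → insideBucket e x ≡ true → pt x ≡ false
      aux (dx , dy) q = trans (cong ((y + dy ≡ᵇ r) ∧_) (≡ᵇ-false (λ eq → <⇒≱ (≰⇒> gt)
          (≤-trans (≤-reflexive (sym eq)) (≤-trans (≤-reflexive (colOf-+ j e dx)) (colOf≤6s j (e + dx) pj (<ᵇ⇒< _ 6 (≡true⇒T q))))))))
          (∧-zeroʳ _)
    ... | yes le with colOf-view s c p3 le
    ...   | j' , k , pj' , pk , refl with j' ≟ j
    ...     | yes refl = trans (cong₂ _∨_ (profileBoard-bucket G j k r pj pk) (any-cong eqel L))
                 (trans (cond k pk r p1 p2) (trans (cong (λ v → bucketCell k v r) (sym (setBucket-here G j g' k))) (sym (profileBoard-bucket (setBucket G j g') j k r pj pk))))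
      where
      eqel : ∀ x → pt x ≡ hitsCell e y k r x
      eqel (dx , dy) = trans (cong ((y + dy ≡ᵇ r) ∧_) (trans (cong (_≡ᵇ colOf j k) (colOf-+ j e dx)) (≡ᵇ-cancelˡ (6 * j + 1) (e + dx) k)))
                             (∧-comm (y + dy ≡ᵇ r) (e + dx ≡ᵇ k))
    ...     | no ne = trans (cong₂ _∨_ (profileBoard-bucket G j' k r pj' pk) (any≡false pt (All.map (λ {x} → aux x) (all≡true⇒All (insideBucket e) L chk))))
                 (trans (∨-identityʳ _) (trans (cong (λ v → bucketCell k v r) (sym (setBucket-there G j g' j' k ne))) (sym (profileBoard-bucket (setBucket G j g') j' k r pj' pk))))
      where
      aux : ∀ x → insideBucket e x ≡ true → pt x ≡ false
      aux (dx , dy) q = trans (cong ((y + dy ≡ᵇ r) ∧_) (≡ᵇ-false (λ eq → ne (sym (proj₁ (colOf-injective (<ᵇ⇒< _ 6 (≡true⇒T q)) pk (trans (sym (colOf-+ j e dx)) eq)))))))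
          (∧-zeroʳ _)

  settle-inBucket : ∀ G a G'' → place (profileBoard G) a ≈ profileBoard G'' → settle d (profileBoard G) a ≈ profileBoard G''
  settle-inBucket G a G'' pe = ≈-trans (clear-resp pe) (clearRows-noFullRow (profileBoard G'') (λ h _ _ → profileBoard-noFullRow G'' h))

  raiseLowCols : Profile → ℕ → ℕ → (ℕ → ℕ) → Profile
  raiseLowCols G j w gn = setBucket G j (λ k → if k <ᵇ 3 then w + gn k else G j k)

  inLowCols : ℕ × ℕ → Bool
  inLowCols (dx , dy) = dx <ᵇ 3

  colOf+≤cols : ∀ j k → j < s → k ≤ 4 → colOf j 0 + k ≤ suc (cols d)
  colOf+≤cols j k pj pk = ≤-trans (+-monoʳ-≤ (colOf j 0) pk) (≤-trans (≤-reflexive (colOf-+ j 0 4))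
                    (≤-trans (colOf≤6s j 4 pj (s≤s (s≤s (s≤s (s≤s (s≤s z≤n))))))
                       (≤-trans (m≤m+n (6 * s) 3) (n≤1+n _))))

  enterAboveBucket : ∀ G p t j → Bounded G → j < s → allUpTo t (allInBox p) ≡ true →
     fits d (profileBoard G) (spawn d p) ≡ true × Reach d (profileBoard G) (spawn d p) (active p t (+ colOf j 0) (+ spawnY p))
  enterAboveBucket G p t j bnd pj bok = enterAndAlign (profileBoard G) p t (colOf j 0) (boxSize p) (profileBoard-aboveH G bnd)
    bok (allUpTo⇒ t (allInBox p) t bok ≤-refl) ≤-refl (1≤colOf j 0) (colOf+≤cols j (boxSize p) pj (boxSize≤4 p))

  -- Dropped at column colOf j 0, piece p in orientation t falls freely to box
  -- row w + suc b', rests there, and turns the low column heights w + g k into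
  -- w + gn k.
  placementCheck : Piece → ℕ → ℕ → (ℕ → ℕ) → (ℕ → ℕ) → Bool
  placementCheck p t b' g gn = allUpTo t (allInBox p)
     ∧ (all (fallsFree 0 g (suc b') (boxSize p)) (localCells p t)
     ∧ (any (landsOn 0 g b') (localCells p t)
     ∧ (all (insideBucket 0) (localCells p t)
     ∧ (all inLowCols (localCells p t)
     ∧ (columnUpdateCheck (localCells p t) (suc b') (g 0) (gn 0) 0
     ∧ (columnUpdateCheck (localCells p t) (suc b') (g 1) (gn 1) 1
     ∧ columnUpdateCheck (localCells p t) (suc b') (g 2) (gn 2) 2))))))

  playPiece : ∀ {ps} G j p t w b' (g gn : ℕ → ℕ) → j < s → Bounded G →
    (∀ k → k < 3 → G j k ≡ w + g k) → placementCheck p t b' g gn ≡ true → w + suc b' ≤ H →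
    Win (profileBoard (raiseLowCols G j w gn)) ps → Win (profileBoard G) (p ∷ ps)
  playPiece G j p t w b' g gn pj bnd hg chk hb win
    with ∧-true⁻ {allUpTo t (allInBox p)} chk
  ... | c0 , ch1 with ∧-true⁻ {all (fallsFree 0 g (suc b') (boxSize p)) (localCells p t)} ch1
  ... | c1 , ch2 with ∧-true⁻ {any (landsOn 0 g b') (localCells p t)} ch2
  ... | c2 , ch3 with ∧-true⁻ {all (insideBucket 0) (localCells p t)} ch3
  ... | c3 , ch4 with ∧-true⁻ {all inLowCols (localCells p t)} ch4
  ... | c4 , ch5 with ∧-true⁻ {columnUpdateCheck (localCells p t) (suc b') (g 0) (gn 0) 0} ch5
  ... | k0 , ch6 with ∧-true⁻ {columnUpdateCheck (localCells p t) (suc b') (g 1) (gn 1) 1} ch6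
  ... | k1 , k2 =
    win-turn a (proj₁ sp) (reach-trans (proj₂ sp) dr) (restsOn G j p t 0 w b' g pj hg c2)
      (win-resp (≈-sym (settle-inBucket G a (raiseLowCols G j w gn) pl)) win)
   where
    L = localCells p t
    a = active p t (+ colOf j 0) (+ (w + suc b'))
    sp = enterAboveBucket G p t j bnd pj c0
    yb : w + suc b' ≤ spawnY p
    yb = <⇒≤ (≤-<-trans hb (H<spawnY p))
    dr : Reach d (profileBoard G) (active p t (+ colOf j 0) (+ spawnY p)) a
    dr = subst (λ z → Reach d (profileBoard G) (active p t (+ colOf j 0) (+ z)) a) (m+[n∸m]≡n yb)
          (dropIntoBucket G j p t 0 w (suc b') g (spawnY p ∸ (w + suc b')) pj hg c1
             (≤-trans (≤-reflexive (cong (_+ boxSize p) (m+[n∸m]≡n yb))) (spawnY-inside p)))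
    nocol : ∀ k → 3 ≤ k → ∀ r → any (hitsCell 0 (w + suc b') k r) L ≡ false
    nocol k k≥3 r = any≡false _ (All.map (λ {x} → aux x) (all≡true⇒All inLowCols L c4))
      where aux : ∀ x → inLowCols x ≡ true → hitsCell 0 (w + suc b') k r x ≡ false
            aux (dx , dy) q = ∧-falseˡ _ (≡ᵇ-false (λ eq → <⇒≱ (<ᵇ⇒< dx 3 (≡true⇒T q)) (subst (3 ≤_) (sym eq) k≥3)))
    cond : ∀ k → k < 6 → ∀ r → 1 ≤ r → r ≤ rows d →
           bucketCell k (G j k) r ∨ any (hitsCell 0 (w + suc b') k r) L ≡ bucketCell k (if k <ᵇ 3 then w + gn k else G j k) r
    cond 0 _ r _ _ = trans (cong (λ v → (r ≤ᵇ v) ∨ any (hitsCell 0 (w + suc b') 0 r) L) (hg 0 (s≤s z≤n)))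
                       (columnUpdate L (suc b') (g 0) (gn 0) 0 k0 w r)
    cond 1 _ r _ _ = trans (cong (λ v → (r ≤ᵇ v) ∨ any (hitsCell 0 (w + suc b') 1 r) L) (hg 1 (s≤s (s≤s z≤n))))
                       (columnUpdate L (suc b') (g 1) (gn 1) 1 k1 w r)
    cond 2 _ r _ _ = trans (cong (λ v → (r ≤ᵇ v) ∨ any (hitsCell 0 (w + suc b') 2 r) L) (hg 2 (s≤s (s≤s (s≤s z≤n)))))
                       (columnUpdate L (suc b') (g 2) (gn 2) 2 k2 w r)
    cond (suc (suc (suc k))) _ r _ _ = trans (cong (bucketCell (suc (suc (suc k))) (G j (suc (suc (suc k)))) r ∨_)
                       (nocol (suc (suc (suc k))) (s≤s (s≤s (s≤s z≤n))) r)) (∨-identityʳ _)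
    pl : place (profileBoard G) a ≈ profileBoard (raiseLowCols G j w gn)
    pl = place-inBucket G j 0 p t (w + suc b') (λ k → if k <ᵇ 3 then w + gn k else G j k) pj c3 cond

  6[1+v]≡6v+6 : ∀ v → 6 * suc v ≡ 6 * v + 6
  6[1+v]≡6v+6 = solve-∀

  notchRow-mod6 : ∀ v → (6 * v + 4 + 1) % 6 ≡ 5
  notchRow-mod6 v = trans (cong (_% 6) (ring v)) ([m+kn]%n≡m%n 5 v 6)
    where ring : ∀ v → 6 * v + 4 + 1 ≡ 5 + v * 6
          ring = solve-∀

  notchRow-unique : ∀ v r → 6 * v ≤ r → r < 6 * v + 6 → r % 6 ≡ 5 → r ≡ 6 * v + 4 + 1
  notchRow-unique v r p q m = trans (sym r≡) (trans (cong (λ z → 6 * v + z) t≡5) (sym (+-assoc (6 * v) 4 1)))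
    where
    t = r ∸ 6 * v
    r≡ : 6 * v + t ≡ r
    r≡ = m+[n∸m]≡n p
    t<6 : t < 6
    t<6 = +-cancelˡ-< (6 * v) t 6 (subst (_< 6 * v + 6) (sym r≡) q)
    t≡5 : t ≡ 5
    t≡5 = trans (sym (m<n⇒m%n≡m t<6)) (trans (sym ([m+kn]%n≡m%n t v 6))
            (trans (cong (_% 6) (trans (+-comm t (v * 6)) (cong (_+ t) (*-comm v 6)))) (trans (cong (_% 6) r≡) m)))

  notch-fill : ∀ v r → 6 * v + 4 + 1 ≤ H → notchCell v r ∨ ((6 * v + 4 + 1 ≡ᵇ r) ∨ false) ≡ notchCell (suc v) r
  notch-fill v r hb with r ≟ 6 * v + 4 + 1
  ... | yes refl = trans (cong (notchCell v (6 * v + 4 + 1) ∨_) (cong (_∨ false) (≡ᵇ-refl (6 * v + 4 + 1))))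
        (trans (∨-zeroʳ _) (sym (trans (∧-trueˡ _ (≤ᵇ-true hb))
          (trans (cong (λ z → not (z ≡ᵇ 5) ∨ (6 * v + 4 + 1 <ᵇ 6 * suc v)) (notchRow-mod6 v))
            (<ᵇ-true (subst (6 * v + 4 + 1 <_) (sym (6[1+v]≡6v+6 v)) (≤-reflexive (ring v))))))))
    where ring : ∀ v → 1 + (6 * v + 4 + 1) ≡ 6 * v + 6
          ring = solve-∀
  ... | no ne = trans (cong (notchCell v r ∨_) (cong (_∨ false) (≡ᵇ-false (λ e → ne (sym e))))) (trans (∨-identityʳ _)
        (cong ((r ≤ᵇ H) ∧_) inner))
    where
    inner : not (r % 6 ≡ᵇ 5) ∨ (r <ᵇ 6 * v) ≡ not (r % 6 ≡ᵇ 5) ∨ (r <ᵇ 6 * suc v)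
    inner with r % 6 ≟ 5
    ... | no m5 = trans (cong (λ z → not z ∨ (r <ᵇ 6 * v)) (≡ᵇ-false m5)) (sym (cong (λ z → not z ∨ (r <ᵇ 6 * suc v)) (≡ᵇ-false m5)))
    ... | yes m5 = trans (cong (λ z → not z ∨ (r <ᵇ 6 * v)) (≡ᵇ-true m5)) (trans lt (sym (cong (λ z → not z ∨ (r <ᵇ 6 * suc v)) (≡ᵇ-true m5))))
      where
      lt : (r <ᵇ 6 * v) ≡ (r <ᵇ 6 * suc v)
      lt with r <? 6 * v
      ... | yes p = trans (<ᵇ-true p) (sym (<ᵇ-true (≤-trans p (*-monoʳ-≤ 6 (n≤1+n v)))))
      ... | no np with r <? 6 * suc v
      ...   | yes q = ⊥-elim (ne (notchRow-unique v r (≮⇒≥ np) (subst (r <_) (6[1+v]≡6v+6 v) q) m5))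
      ...   | no nq = trans (<ᵇ-false (≮⇒≥ np)) (sym (<ᵇ-false (≮⇒≥ nq)))

cols3 : ℕ → ℕ → ℕ → ℕ → ℕ
cols3 a b c 0 = a
cols3 a b c 1 = b
cols3 a b c 2 = c
cols3 a b c _ = 0

cols5 : ℕ → ℕ → ℕ → ℕ → ℕ → ℕ → ℕ
cols5 a b c d e 0 = a
cols5 a b c d e 1 = b
cols5 a b c d e 2 = c
cols5 a b c d e 3 = d
cols5 a b c d e 4 = e
cols5 a b c d e _ = 0

∧-true₄ : ∀ {a b c e} → a ≡ true → b ≡ true → c ≡ true → e ≡ true → a ∧ (b ∧ (c ∧ (e ∧ true))) ≡ true
∧-true₄ refl refl refl refl = refl

≤-lit : ∀ m n → {T (m ≤ᵇ n)} → m ≤ n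
≤-lit m n {p} = ≤ᵇ⇒≤ m n p

module Gadgets (s T : ℕ) (s≥1 : 1 ≤ s) where
  open Construction s T s≥1 public

  Shaped : Profile → ℕ → (ℕ → ℕ) → Set
  Shaped G j X = ∀ k → k < 5 → G j k ≡ X k

  -- Profiles are compared only through Agree (there is no function
  -- extensionality), so every gadget passes the next profile to a continuation
  -- accepting any profile that agrees with the intended one.
  Continue : List Piece → Profile → ℕ → (ℕ → ℕ) → Set
  Continue ps G j Y = ∀ G' → Agree G' (setBucket G j Y) → Bounded G' → Win (profileBoard G') ps

  shaped-setBucket : ∀ {G' G j Y} → Agree G' (setBucket G j Y) → j < s → Shaped G' j Y
  shaped-setBucket {G'} {G} {j} {Y} ag pj k pk = trans (ag j k pj pk) (setBucket-here G j Y k)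

  agree-chain : ∀ {G2 G1 G j Y Z} → Agree G2 (setBucket G1 j Y) → Agree G1 (setBucket G j Z) → Agree G2 (setBucket G j Y)
  agree-chain {G2} {G1} {G} {j} {Y} {Z} a2 a1 j' k pj pk with j' ≟ j
  ... | yes refl = trans (a2 j k pj pk) (trans (setBucket-here G1 j Y k) (sym (setBucket-here G j Y k)))
  ... | no ne = trans (a2 j' k pj pk) (trans (setBucket-there G1 j Y j' k ne) (trans (a1 j' k pj pk)
                  (trans (setBucket-there G j Z j' k ne) (sym (setBucket-there G j Y j' k ne)))))

  bounded-agree : ∀ {G' G j Y} → Agree G' (setBucket G j Y) → Bounded G → (∀ k → k < 3 → Y k ≤ H) → Bounded G'
  bounded-agree {G'} {G} {j} {Y} ag bnd yb j' k pj pk with j' ≟ j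
  ... | yes refl = subst (_≤ H) (sym (trans (ag j k pj (<-trans pk (s≤s (s≤s (s≤s (s≤s z≤n)))))) (setBucket-here G j Y k))) (yb k pk)
  ... | no ne = subst (_≤ H) (sym (trans (ag j' k pj (<-trans pk (s≤s (s≤s (s≤s (s≤s z≤n)))))) (setBucket-there G j Y j' k ne))) (bnd j' k pj pk)

  playShaped : ∀ {ps} G j p t w b' (g gn Y : ℕ → ℕ) → j < s → Bounded G → (∀ k → k < 3 → G j k ≡ w + g k) →
    placementCheck p t b' g gn ≡ true → w + suc b' ≤ H →
    (∀ k → k < 3 → w + gn k ≡ Y k) → (∀ k → 3 ≤ k → k < 5 → G j k ≡ Y k) → (∀ k → k < 3 → Y k ≤ H) →
    Continue ps G j Y → Win (profileBoard G) (p ∷ ps)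
  playShaped G j p t w b' g gn Y pj bnd hg chk hb e1 e2 yb cont =
    playPiece G j p t w b' g gn pj bnd hg chk hb (cont (raiseLowCols G j w gn) ag (bounded-agree ag bnd yb))
    where
    gg : ℕ → ℕ
    gg k = if k <ᵇ 3 then w + gn k else G j k
    ag : Agree (raiseLowCols G j w gn) (setBucket G j Y)
    ag j' k pj' pk with j' ≟ j
    ... | no ne = trans (setBucket-there G j gg j' k ne) (sym (setBucket-there G j Y j' k ne))
    ... | yes refl = trans (setBucket-here G j gg k) (trans inner (sym (setBucket-here G j Y k)))
      where
      inner : (if k <ᵇ 3 then w + gn k else G j k) ≡ Y k
      inner with k <? 3
      ... | yes p = trans (if-true (<ᵇ-true p)) (e1 k p)
      ... | no np = trans (if-false (<ᵇ-false (≮⇒≥ np))) (e2 k (≮⇒≥ np) pk)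

  notchProfile : Profile → ℕ → ℕ → ℕ → ℕ
  notchProfile G j v k = if k ≡ᵇ 2 then 6 * v + 6 else if (k ≡ᵇ 3) ∨ (k ≡ᵇ 4) then suc v else G j k

  openCell : ∀ G j k h → j < s → k < 6 → 1 ≤ h → h ≤ rows d → bucketCell k (G j k) h ≡ false →
     ∀ x dx → x + dx ≡ colOf j k → isOpen d (profileBoard G) (+ h) (+ (x + dx)) ≡ true
  openCell G j k h pj pk p1 p2 e x dx eq = subst (λ z → isOpen d (profileBoard G) (+ h) (+ z) ≡ true) (sym eq)
    (isOpen-true {profileBoard G} {h} {colOf j k} p1 p2 (1≤colOf j k) (colOf≤cols j k pj pk) (trans (profileBoard-bucket G j k h pj pk) e))

  notchOpen : ∀ v → notchCell v (6 * v + 4 + 1) ≡ false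
  notchOpen v = trans (cong (λ z → (6 * v + 4 + 1 ≤ᵇ H) ∧ (not (z ≡ᵇ 5) ∨ (6 * v + 4 + 1 <ᵇ 6 * v))) (notchRow-mod6 v))
     (trans (cong ((6 * v + 4 + 1 ≤ᵇ H) ∧_) (<ᵇ-false (≤-trans (m≤m+n (6 * v) 4) (m≤m+n (6 * v + 4) 1)))) (∧-zeroʳ _))

  -- Resting on the low columns at height 6v+4, the LG piece can still slide right
  -- by two: its lower arm passes through the open notch row 6v+5 of columns 3, 4.
  slideIntoNotch : ∀ G j v → j < s → (∀ k → k < 3 → G j k ≡ 6 * v + 4) → G j 3 ≡ v → G j 4 ≡ v → 6 * v + 6 ≤ H →
    Reach d (profileBoard G) (active LG 0 (+ colOf j 0) (+ (6 * v + 4))) (active LG 0 (+ colOf j 2) (+ (6 * v + 4)))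
  slideIntoNotch G j v pj hg h3 h4 hb = reach-trans sl1 sl2
    where
    w = 6 * v
    hb4 : w + 4 ≤ H
    hb4 = ≤-trans (+-monoʳ-≤ w (≤-lit 4 6)) hb
    rowOK : ∀ c → c ≤ 2 → 1 ≤ w + 4 + c × w + 4 + c ≤ rows d
    rowOK c c≤2 = ≤-trans (s≤s z≤n) (≤-trans (m≤n+m 4 w) (m≤m+n (w + 4) c)) ,
                  ≤-trans (+-monoʳ-≤ (w + 4) c≤2) (≤-trans (+-monoˡ-≤ 2 hb4) (≤-trans (m≤m+n (H + 2) (3 * s + 2)) (≤-reflexive (ring H (3 * s)))))
      where
      ring : ∀ a b → a + 2 + (b + 2) ≡ a + b + 4
      ring = solve-∀
    lo : ∀ k h → k < 3 → w + 4 < h → bucketCell k (G j k) h ≡ false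
    lo k h pk p = lowCell-false k (G j k) h pk (subst (_< h) (sym (hg k pk)) p)
    w45 : w + 4 < w + 4 + 1
    w45 = subst (w + 4 <_) (sym (+-comm (w + 4) 1)) ≤-refl
    w46 : w + 4 < w + 4 + 2
    w46 = subst (w + 4 <_) (sym (+-comm (w + 4) 2)) (n≤1+n _)
    n3 : bucketCell 3 (G j 3) (w + 4 + 1) ≡ false
    n3 = trans (cong (λ z → bucketCell 3 z (w + 4 + 1)) h3) (notchOpen v)
    n4 : bucketCell 4 (G j 4) (w + 4 + 1) ≡ false
    n4 = trans (cong (λ z → bucketCell 4 z (w + 4 + 1)) h4) (notchOpen v)
    fit1 : fits d (profileBoard G) (active LG 0 (+ colOf j 1) (+ (w + 4))) ≡ true
    fit1 = ∧-true₄ (openCell G j 1 _ pj (<ᵇ⇒< 1 6 _) (proj₁ (rowOK 2 ≤-refl)) (proj₂ (rowOK 2 ≤-refl)) (lo 1 _ (<ᵇ⇒< 1 3 _) w46) (colOf j 1) 0 (+-identityʳ _))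
              (openCell G j 1 _ pj (<ᵇ⇒< 1 6 _) (proj₁ (rowOK 1 (n≤1+n 1))) (proj₂ (rowOK 1 (n≤1+n 1))) (lo 1 _ (<ᵇ⇒< 1 3 _) w45) (colOf j 1) 0 (+-identityʳ _))
              (openCell G j 2 _ pj (<ᵇ⇒< 2 6 _) (proj₁ (rowOK 1 (n≤1+n 1))) (proj₂ (rowOK 1 (n≤1+n 1))) (lo 2 _ (<ᵇ⇒< 2 3 _) w45) (colOf j 1) 1 (colOf-+ j 1 1))
              (openCell G j 3 _ pj (<ᵇ⇒< 3 6 _) (proj₁ (rowOK 1 (n≤1+n 1))) (proj₂ (rowOK 1 (n≤1+n 1))) n3 (colOf j 1) 2 (colOf-+ j 1 2))
    fit2 : fits d (profileBoard G) (active LG 0 (+ colOf j 2) (+ (w + 4))) ≡ true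
    fit2 = ∧-true₄ (openCell G j 2 _ pj (<ᵇ⇒< 2 6 _) (proj₁ (rowOK 2 ≤-refl)) (proj₂ (rowOK 2 ≤-refl)) (lo 2 _ (<ᵇ⇒< 2 3 _) w46) (colOf j 2) 0 (+-identityʳ _))
              (openCell G j 2 _ pj (<ᵇ⇒< 2 6 _) (proj₁ (rowOK 1 (n≤1+n 1))) (proj₂ (rowOK 1 (n≤1+n 1))) (lo 2 _ (<ᵇ⇒< 2 3 _) w45) (colOf j 2) 0 (+-identityʳ _))
              (openCell G j 3 _ pj (<ᵇ⇒< 3 6 _) (proj₁ (rowOK 1 (n≤1+n 1))) (proj₂ (rowOK 1 (n≤1+n 1))) n3 (colOf j 2) 1 (colOf-+ j 2 1))
              (openCell G j 4 _ pj (<ᵇ⇒< 4 6 _) (proj₁ (rowOK 1 (n≤1+n 1))) (proj₂ (rowOK 1 (n≤1+n 1))) n4 (colOf j 2) 2 (colOf-+ j 2 2))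
    sl1 : Reach d (profileBoard G) (active LG 0 (+ colOf j 0) (+ (w + 4))) (active LG 0 (+ colOf j 1) (+ (w + 4)))
    sl1 = move slideR (cong (λ z → active LG 0 (+ z) (+ (w + 4))) (colOf-+ j 0 1)) fit1
    sl2 : Reach d (profileBoard G) (active LG 0 (+ colOf j 1) (+ (w + 4))) (active LG 0 (+ colOf j 2) (+ (w + 4)))
    sl2 = move slideR (cong (λ z → active LG 0 (+ z) (+ (w + 4))) (colOf-+ j 1 1)) fit2

  place-notch : ∀ G j v → j < s → (∀ k → k < 3 → G j k ≡ 6 * v + 4) → G j 3 ≡ v → G j 4 ≡ v → 6 * v + 6 ≤ H →
    place (profileBoard G) (active LG 0 (+ colOf j 2) (+ (6 * v + 4))) ≈ profileBoard (setBucket G j (notchProfile G j v))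
  place-notch G j v pj hg h3 h4 hb = place-inBucket G j 2 LG 0 (w + 4) (notchProfile G j v) pj refl cond
    where
    w = 6 * v
    L = localCells LG 0
    h5 : w + 4 + 1 ≤ H
    h5 = ≤-trans (≤-trans (≤-reflexive (+-assoc w 4 1)) (+-monoʳ-≤ w (n≤1+n 5))) hb
    cond : ∀ k → k < 6 → ∀ r → 1 ≤ r → r ≤ rows d → bucketCell k (G j k) r ∨ any (hitsCell 2 (w + 4) k r) L ≡ bucketCell k (notchProfile G j v k) r
    cond 0 _ r _ _ = ∨-identityʳ _
    cond 1 _ r _ _ = ∨-identityʳ _
    cond 2 _ r _ _ = trans (cong (λ z → (r ≤ᵇ z) ∨ any (hitsCell 2 (w + 4) 2 r) L) (hg 2 (<ᵇ⇒< 2 3 _)))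
                        (columnUpdate ((2 , 2) ∷ (2 , 1) ∷ (3 , 1) ∷ (4 , 1) ∷ []) 4 4 6 2 refl w r)
    cond 3 _ r _ _ = trans (cong (λ z → bucketCell 3 z r ∨ any (hitsCell 2 (w + 4) 3 r) L) h3) (notch-fill v r h5)
    cond 4 _ r _ _ = trans (cong (λ z → bucketCell 4 z r ∨ any (hitsCell 2 (w + 4) 4 r) L) h4) (notch-fill v r h5)
    cond (suc (suc (suc (suc (suc k))))) _ r _ _ = ∨-identityʳ _

  playNotch : ∀ {ps} G j v → j < s → Bounded G → (∀ k → k < 3 → G j k ≡ 6 * v + 4) → G j 3 ≡ v → G j 4 ≡ v → 6 * v + 6 ≤ H →
     Win (profileBoard (setBucket G j (notchProfile G j v))) ps → Win (profileBoard G) (LG ∷ ps)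
  playNotch G j v pj bnd hg h3 h4 hb win =
    win-turn a (proj₁ sp) (reach-trans (proj₂ sp) (reach-trans dr (slideIntoNotch G j v pj hg h3 h4 hb)))
      (restsOn G j LG 0 2 w 3 (cols3 4 4 4) pj hg' refl)
      (win-resp (≈-sym (settle-inBucket G a (setBucket G j (notchProfile G j v)) (place-notch G j v pj hg h3 h4 hb))) win)
    where
    w = 6 * v
    hg' : ∀ k → k < 3 → G j k ≡ w + cols3 4 4 4 k
    hg' 0 p = hg 0 p
    hg' 1 p = hg 1 p
    hg' 2 p = hg 2 p
    hg' (suc (suc (suc k))) (s≤s (s≤s (s≤s ())))
    a = active LG 0 (+ colOf j 2) (+ (w + 4))
    sp = enterAboveBucket G LG 0 j bnd pj refl
    yb : w + 4 ≤ spawnY LG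
    yb = <⇒≤ (≤-<-trans (≤-trans (+-monoʳ-≤ w (≤-lit 4 6)) hb) (H<spawnY LG))
    dr : Reach d (profileBoard G) (active LG 0 (+ colOf j 0) (+ spawnY LG)) (active LG 0 (+ colOf j 0) (+ (w + 4)))
    dr = subst (λ z → Reach d (profileBoard G) (active LG 0 (+ colOf j 0) (+ z)) (active LG 0 (+ colOf j 0) (+ (w + 4)))) (m+[n∸m]≡n yb)
          (dropIntoBucket G j LG 0 0 w 4 (cols3 4 4 4) (spawnY LG ∸ (w + 4)) pj hg' refl
             (≤-trans (≤-reflexive (cong (_+ 3) (m+[n∸m]≡n yb))) (spawnY-inside LG)))

  -- An item a takes ready v to ready (v + a + 1):
  -- I LG Sq lead to flat (v + 1), each filler block LG LS LG LG Sq adds a level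
  -- (through filling₁, filling₂, flat4, notched), and Sq Sq pass through closing.
  ready flat4 notched flat filling₁ filling₂ closing : ℕ → ℕ → ℕ
  ready v = cols5 (6 * v + 4) (6 * v + 4) (6 * v) v v
  flat4 v = cols5 (6 * v + 4) (6 * v + 4) (6 * v + 4) v v
  notched v = cols5 (6 * v + 4) (6 * v + 4) (6 * v + 6) (suc v) (suc v)
  flat v = cols5 (6 * v) (6 * v) (6 * v) v v
  filling₁ v = cols5 (6 * v + 8) (6 * v + 7) (6 * v + 7) (suc v) (suc v)
  filling₂ v = cols5 (6 * v + 9) (6 * v + 9) (6 * v + 8) (suc v) (suc v)
  closing v = cols5 (6 * v + 2) (6 * v + 2) (6 * v) v v

  forLowCols : ∀ {P : ℕ → Set} → P 0 → P 1 → P 2 → ∀ k → k < 3 → P k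
  forLowCols p0 p1 p2 0 _ = p0
  forLowCols p0 p1 p2 1 _ = p1
  forLowCols p0 p1 p2 2 _ = p2
  forLowCols p0 p1 p2 (suc (suc (suc k))) (s≤s (s≤s (s≤s ())))

  forNotchCols : ∀ {P : ℕ → Set} → P 3 → P 4 → ∀ k → 3 ≤ k → k < 5 → P k
  forNotchCols p3 p4 3 _ _ = p3
  forNotchCols p3 p4 4 _ _ = p4
  forNotchCols p3 p4 (suc (suc (suc (suc (suc k))))) _ (s≤s (s≤s (s≤s (s≤s (s≤s ())))))
  forNotchCols p3 p4 0 () _
  forNotchCols p3 p4 1 (s≤s ()) _
  forNotchCols p3 p4 2 (s≤s (s≤s ())) _

  initialProfile : Profile
  initialProfile j k = ready 0 k

  initialProfile-bounded : Bounded initialProfile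
  initialProfile-bounded j k _ pk = forLowCols {λ k → ready 0 k ≤ H} h4 h4 z≤n k pk
    where h4 : 4 ≤ H
          h4 = ≤-trans (≤-lit 4 22) (m≤n+m 22 (6 * T))

  initBoard≈profileBoard : initBoard s T ≈ profileBoard initialProfile
  initBoard≈profileBoard r c p1 p2 p3 p4 with r ≤? H
  ... | no nrH = trans (if-false (trans (∧-trueˡ _ (≤ᵇ-true p1)) (∧-falseˡ _ (≤ᵇ-false (≰⇒> nrH))))) (sym (profileBoard-aboveH initialProfile initialProfile-bounded r c (≰⇒> nrH) p3))
  ... | yes rH = trans (if-true (trans (∧-trueˡ _ (≤ᵇ-true p1)) (trans (∧-trueˡ _ (≤ᵇ-true rH)) (≤ᵇ-true p3)))) inner
    where
    inner : (if c ≤ᵇ 6 * s then bucketCol ((c ∸ 1) % 6) r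
             else if c ≡ᵇ 6 * s + 1 then r ≤ᵇ 6 * T + 20
             else if c ≡ᵇ 6 * s + 2 then r ≤ᵇ 6 * T + 21
             else if c ≡ᵇ 6 * s + 3 then r ≡ᵇ 6 * T + 21
             else false) ≡ profileBoard initialProfile r c
    inner with c ≤? 6 * s
    ... | no gt = trans (if-false (≤ᵇ-false (≰⇒> gt))) (sym (trans (profileBoard-lock initialProfile r c (≰⇒> gt)) (∧-trueˡ _ (≤ᵇ-true rH))))
    ... | yes le with colOf-view s c p3 le
    ...   | j , k , pj , pk , refl = trans (if-true (≤ᵇ-true le)) (trans (cong (λ z → bucketCol z r) (colOf-mod j k pk))
             (trans (cases k pk) (sym (profileBoard-bucket initialProfile j k r pj pk))))
      where
      cases : ∀ k → k < 6 → bucketCol k r ≡ bucketCell k (initialProfile j k) r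
      cases 0 _ = refl
      cases 1 _ = refl
      cases 2 _ = sym (≤ᵇ-false p1)
      cases 3 _ = sym (trans (∧-trueˡ _ (≤ᵇ-true rH)) (∨-identityʳ _))
      cases 4 _ = sym (trans (∧-trueˡ _ (≤ᵇ-true rH)) (∨-identityʳ _))
      cases 5 _ = sym (≤ᵇ-true rH)
      cases (suc (suc (suc (suc (suc (suc k)))))) (s≤s (s≤s (s≤s (s≤s (s≤s (s≤s ()))))))

  ≤H-offset : ∀ v a b → a ≤ b → 6 * v + b ≤ H → 6 * v + a ≤ H
  ≤H-offset v a b p h = ≤-trans (+-monoʳ-≤ (6 * v) p) h

  ≤H-level : ∀ v u c → v ≤ u → 6 * u + c ≤ H → 6 * v + c ≤ H
  ≤H-level v u c p h = ≤-trans (+-monoˡ-≤ c (*-monoʳ-≤ 6 p)) h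

  6[T+2]+10≡H : 6 * (T + 2) + 10 ≡ H
  6[T+2]+10≡H = ring T where
    ring : ∀ T → 6 * (T + 2) + 10 ≡ 6 * T + 22
    ring = solve-∀
  6[T+3]+4≡H : 6 * (T + 3) + 4 ≡ H
  6[T+3]+4≡H = ring T where
    ring : ∀ T → 6 * (T + 3) + 4 ≡ 6 * T + 22
    ring = solve-∀

  6v+10≡6[1+v]+4 : ∀ v → 6 * v + 10 ≡ 6 * suc v + 4
  6v+10≡6[1+v]+4 = solve-∀

  6v≡6v+0 : ∀ v → 6 * v ≡ 6 * v + 0
  6v≡6v+0 v = sym (+-identityʳ (6 * v))

  agree-same : ∀ G j g Y → (∀ k → k < 5 → g k ≡ Y k) → Agree (setBucket G j g) (setBucket G j Y)
  agree-same G j g Y e j' k pj pk with j' ≟ j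
  ... | yes refl = trans (setBucket-here G j g k) (trans (e k pk) (sym (setBucket-here G j Y k)))
  ... | no ne = trans (setBucket-there G j g j' k ne) (sym (setBucket-there G j Y j' k ne))

  agree-self : ∀ G j Y → Shaped G j Y → Agree G (setBucket G j Y)
  agree-self G j Y is j' k pj pk with j' ≟ j
  ... | yes refl = trans (is k pk) (sym (setBucket-here G j Y k))
  ... | no ne = sym (setBucket-there G j Y j' k ne)

  I-on-ready : ∀ {ps} G j v → j < s → Bounded G → Shaped G j (ready v) → 6 * v + 4 ≤ H → Continue ps G j (flat4 v) → Win (profileBoard G) (I ∷ ps)
  I-on-ready G j v pj bnd is hb cont = playShaped G j I 1 (6 * v) 0 (cols3 4 4 0) (cols3 4 4 4) (flat4 v) pj bnd
    (forLowCols (is 0 (≤-lit 1 5)) (is 1 (≤-lit 2 5)) (trans (is 2 (≤-lit 3 5)) (6v≡6v+0 v))) refl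
    (≤H-offset v 1 4 (≤-lit 1 4) hb) (forLowCols refl refl refl) (forNotchCols (is 3 (≤-lit 4 5)) (is 4 (≤-lit 5 5))) (forLowCols hb hb hb) cont

  LG-on-flat4 : ∀ {ps} G j v → j < s → Bounded G → Shaped G j (flat4 v) → 6 * v + 6 ≤ H → Continue ps G j (notched v) → Win (profileBoard G) (LG ∷ ps)
  LG-on-flat4 G j v pj bnd is hb cont = playNotch G j v pj bnd (forLowCols (is 0 (≤-lit 1 5)) (is 1 (≤-lit 2 5)) (is 2 (≤-lit 3 5)))
    (is 3 (≤-lit 4 5)) (is 4 (≤-lit 5 5)) hb
    (cont _ ag (bounded-agree ag bnd (forLowCols (≤H-offset v 4 6 (≤-lit 4 6) hb) (≤H-offset v 4 6 (≤-lit 4 6) hb) hb)))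
    where
    eq : ∀ k → k < 5 → notchProfile G j v k ≡ notched v k
    eq 0 _ = is 0 (≤-lit 1 5)
    eq 1 _ = is 1 (≤-lit 2 5)
    eq 2 _ = refl
    eq 3 _ = refl
    eq 4 _ = refl
    eq (suc (suc (suc (suc (suc k))))) (s≤s (s≤s (s≤s (s≤s (s≤s ())))))
    ag : Agree (setBucket G j (notchProfile G j v)) (setBucket G j (notched v))
    ag = agree-same G j (notchProfile G j v) (notched v) eq

  Sq-on-notched : ∀ {ps} G j v → j < s → Bounded G → Shaped G j (notched v) → 6 * v + 6 ≤ H → Continue ps G j (flat (suc v)) → Win (profileBoard G) (Sq ∷ ps)
  Sq-on-notched G j v pj bnd is hb cont = playShaped G j Sq 0 (6 * v) 4 (cols3 4 4 6) (cols3 6 6 6) (flat (suc v)) pj bnd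
    (forLowCols (is 0 (≤-lit 1 5)) (is 1 (≤-lit 2 5)) (is 2 (≤-lit 3 5))) refl
    (≤H-offset v 5 6 (≤-lit 5 6) hb) (forLowCols (sym (6[1+v]≡6v+6 v)) (sym (6[1+v]≡6v+6 v)) (sym (6[1+v]≡6v+6 v))) (forNotchCols (is 3 (≤-lit 4 5)) (is 4 (≤-lit 5 5)))
    (forLowCols h' h' h') cont
    where h' = subst (_≤ H) (sym (6[1+v]≡6v+6 v)) hb

  LG-on-flat : ∀ {ps} G j v → j < s → Bounded G → Shaped G j (flat (suc v)) → 6 * v + 10 ≤ H → Continue ps G j (filling₁ v) → Win (profileBoard G) (LG ∷ ps)
  LG-on-flat G j v pj bnd is hb cont = playShaped G j LG 0 (6 * v) 5 (cols3 6 6 6) (cols3 8 7 7) (filling₁ v) pj bnd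
    (forLowCols (trans (is 0 (≤-lit 1 5)) (6[1+v]≡6v+6 v)) (trans (is 1 (≤-lit 2 5)) (6[1+v]≡6v+6 v)) (trans (is 2 (≤-lit 3 5)) (6[1+v]≡6v+6 v))) refl
    (≤H-offset v 6 10 (≤-lit 6 10) hb) (forLowCols refl refl refl) (forNotchCols (is 3 (≤-lit 4 5)) (is 4 (≤-lit 5 5)))
    (forLowCols (≤H-offset v 8 10 (≤-lit 8 10) hb) (≤H-offset v 7 10 (≤-lit 7 10) hb) (≤H-offset v 7 10 (≤-lit 7 10) hb)) cont

  LS-on-filling₁ : ∀ {ps} G j v → j < s → Bounded G → Shaped G j (filling₁ v) → 6 * v + 10 ≤ H → Continue ps G j (filling₂ v) → Win (profileBoard G) (LS ∷ ps)
  LS-on-filling₁ G j v pj bnd is hb cont = playShaped G j LS 0 (6 * v) 6 (cols3 8 7 7) (cols3 9 9 8) (filling₂ v) pj bnd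
    (forLowCols (is 0 (≤-lit 1 5)) (is 1 (≤-lit 2 5)) (is 2 (≤-lit 3 5))) refl
    (≤H-offset v 7 10 (≤-lit 7 10) hb) (forLowCols refl refl refl) (forNotchCols (is 3 (≤-lit 4 5)) (is 4 (≤-lit 5 5)))
    (forLowCols (≤H-offset v 9 10 (≤-lit 9 10) hb) (≤H-offset v 9 10 (≤-lit 9 10) hb) (≤H-offset v 8 10 (≤-lit 8 10) hb)) cont

  LG-on-filling₂ : ∀ {ps} G j v → j < s → Bounded G → Shaped G j (filling₂ v) → 6 * v + 10 ≤ H → Continue ps G j (flat4 (suc v)) → Win (profileBoard G) (LG ∷ ps)
  LG-on-filling₂ G j v pj bnd is hb cont = playShaped G j LG 2 (6 * v) 8 (cols3 9 9 8) (cols3 10 10 10) (flat4 (suc v)) pj bnd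
    (forLowCols (is 0 (≤-lit 1 5)) (is 1 (≤-lit 2 5)) (is 2 (≤-lit 3 5))) refl
    (≤H-offset v 9 10 (≤-lit 9 10) hb) (forLowCols (6v+10≡6[1+v]+4 v) (6v+10≡6[1+v]+4 v) (6v+10≡6[1+v]+4 v)) (forNotchCols (is 3 (≤-lit 4 5)) (is 4 (≤-lit 5 5)))
    (forLowCols h' h' h') cont
    where h' = subst (_≤ H) (6v+10≡6[1+v]+4 v) hb

  Sq-on-flat : ∀ {ps} G j v → j < s → Bounded G → Shaped G j (flat v) → 6 * v + 4 ≤ H → Continue ps G j (closing v) → Win (profileBoard G) (Sq ∷ ps)
  Sq-on-flat G j v pj bnd is hb cont = playShaped G j Sq 0 (6 * v) 0 (cols3 0 0 0) (cols3 2 2 0) (closing v) pj bnd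
    (forLowCols (trans (is 0 (≤-lit 1 5)) (6v≡6v+0 v)) (trans (is 1 (≤-lit 2 5)) (6v≡6v+0 v)) (trans (is 2 (≤-lit 3 5)) (6v≡6v+0 v))) refl
    (≤H-offset v 1 4 (≤-lit 1 4) hb) (forLowCols refl refl (sym (6v≡6v+0 v))) (forNotchCols (is 3 (≤-lit 4 5)) (is 4 (≤-lit 5 5)))
    (forLowCols (≤H-offset v 2 4 (≤-lit 2 4) hb) (≤H-offset v 2 4 (≤-lit 2 4) hb) (≤H-offset v 0 4 (≤-lit 0 4) hb |> subst (_≤ H) (+-identityʳ _))) cont

  Sq-on-closing : ∀ {ps} G j v → j < s → Bounded G → Shaped G j (closing v) → 6 * v + 4 ≤ H → Continue ps G j (ready v) → Win (profileBoard G) (Sq ∷ ps)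
  Sq-on-closing G j v pj bnd is hb cont = playShaped G j Sq 0 (6 * v) 2 (cols3 2 2 0) (cols3 4 4 0) (ready v) pj bnd
    (forLowCols (is 0 (≤-lit 1 5)) (is 1 (≤-lit 2 5)) (trans (is 2 (≤-lit 3 5)) (6v≡6v+0 v))) refl
    (≤H-offset v 3 4 (≤-lit 3 4) hb) (forLowCols refl refl (sym (6v≡6v+0 v))) (forNotchCols (is 3 (≤-lit 4 5)) (is 4 (≤-lit 5 5)))
    (forLowCols hb hb (≤H-offset v 0 4 (≤-lit 0 4) hb |> subst (_≤ H) (+-identityʳ _))) cont

  agree-other : ∀ {G' G j0 Y} → Agree G' (setBucket G j0 Y) → ∀ j → j ≢ j0 → j < s → ∀ k → k < 5 → G' j k ≡ G j k
  agree-other {G'} {G} {j0} {Y} ag j ne pj k pk = trans (ag j k pj pk) (setBucket-there G j0 Y j k ne)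

  Shaped-subst : ∀ {G j} (F : ℕ → ℕ → ℕ) {x y} → x ≡ y → Shaped G j (F x) → Shaped G j (F y)
  Shaped-subst F refl is = is

  playFillers : ∀ a {ps} G j v → j < s → Bounded G → Shaped G j (flat (suc v)) → v + a ≤ T + 2 →
     Continue ps G j (flat (suc (v + a))) → Win (profileBoard G) (concat (replicate a fillerBlock) ++ ps)
  playFillers zero G j v pj bnd is b cont =
    cont G (subst (λ z → Agree G (setBucket G j (flat (suc z)))) (sym (+-identityʳ v)) (agree-self G j _ is)) bnd
  playFillers (suc a) G j v pj bnd is b cont =
    LG-on-flat G j v pj bnd is h10 (λ G1 a1 b1 →
    LS-on-filling₁ G1 j v pj b1 (shaped-setBucket a1 pj) h10 (λ G2 a2 b2 →
    LG-on-filling₂ G2 j v pj b2 (shaped-setBucket a2 pj) h10 (λ G3 a3 b3 →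
    LG-on-flat4 G3 j (suc v) pj b3 (shaped-setBucket a3 pj) h6 (λ G4 a4 b4 →
    Sq-on-notched G4 j (suc v) pj b4 (shaped-setBucket a4 pj) h6 (λ G5 a5 b5 →
    playFillers a G5 j (suc v) pj b5 (shaped-setBucket a5 pj) b' (λ G6 a6 b6 →
    cont G6 (subst (λ z → Agree G6 (setBucket G j (flat (suc z)))) (sym (+-suc v a))
       (agree-chain (agree-chain (agree-chain (agree-chain (agree-chain a6 a5) a4) a3) a2) a1)) b6))))))
    where
    vb : v ≤ T + 2
    vb = ≤-trans (m≤m+n v (suc a)) b
    h10 : 6 * v + 10 ≤ H
    h10 = ≤H-level v (T + 2) 10 vb (≤-reflexive 6[T+2]+10≡H)
    b' : suc v + a ≤ T + 2
    b' = subst (_≤ T + 2) (+-suc v a) b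
    h6 : 6 * suc v + 6 ≤ H
    h6 = ≤H-level (suc v) (T + 2) 6 (≤-trans (s≤s (m≤m+n v a)) b') (≤-trans (+-monoʳ-≤ (6 * (T + 2)) (≤-lit 6 10)) (≤-reflexive 6[T+2]+10≡H))

  itemPieces : ℕ → List Piece
  itemPieces a = (I ∷ LG ∷ Sq ∷ []) ++ concat (replicate a fillerBlock) ++ (Sq ∷ Sq ∷ [])

  playItem : ∀ a {ps} G j v → j < s → Bounded G → Shaped G j (ready v) → v + a ≤ T + 2 →
     Continue ps G j (ready (suc (v + a))) → Win (profileBoard G) (itemPieces a ++ ps)
  playItem a {ps} G j v pj bnd is b cont =
    subst (λ z → Win (profileBoard G) (I ∷ LG ∷ Sq ∷ z)) (sym (++-assoc (concat (replicate a fillerBlock)) (Sq ∷ Sq ∷ []) ps)) (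
    I-on-ready G j v pj bnd is h4 (λ G1 a1 b1 →
    LG-on-flat4 G1 j v pj b1 (shaped-setBucket a1 pj) h6 (λ G2 a2 b2 →
    Sq-on-notched G2 j v pj b2 (shaped-setBucket a2 pj) h6 (λ G3 a3 b3 →
    playFillers a G3 j v pj b3 (shaped-setBucket a3 pj) b (λ G4 a4 b4 →
    Sq-on-flat G4 j (suc (v + a)) pj b4 (shaped-setBucket a4 pj) hE (λ G5 a5 b5 →
    Sq-on-closing G5 j (suc (v + a)) pj b5 (shaped-setBucket a5 pj) hE (λ G6 a6 b6 →
    cont G6 (agree-chain (agree-chain (agree-chain (agree-chain (agree-chain a6 a5) a4) a3) a2) a1) b6)))))))
    where
    vb : v ≤ T + 2
    vb = ≤-trans (m≤m+n v a) b
    h6 : 6 * v + 6 ≤ H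
    h6 = ≤H-level v (T + 2) 6 vb (≤-trans (+-monoʳ-≤ (6 * (T + 2)) (≤-lit 6 10)) (≤-reflexive 6[T+2]+10≡H))
    h4 : 6 * v + 4 ≤ H
    h4 = ≤H-offset v 4 6 (≤-lit 4 6) h6
    hE : 6 * suc (v + a) + 4 ≤ H
    hE = ≤H-level (suc (v + a)) (T + 3) 4 (subst (suc (v + a) ≤_) (sym (+-suc T 2)) (s≤s b)) (≤-reflexive 6[T+3]+4≡H)

  playItems : ∀ {n} (bk a : Fin n → ℕ) (is : List (Fin n)) {ps} G (base : ℕ → ℕ) →
    (∀ i → bk i < s) → Bounded G → (∀ j → j < s → Shaped G j (ready (base j))) →
    (∀ j → j < s → base j + load bk a is j ≤ T + 3) →
    (∀ G' → (∀ j → j < s → Shaped G' j (ready (base j + load bk a is j))) → Bounded G' → Win (profileBoard G') ps) →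
    Win (profileBoard G) (concatMap (λ i → itemPieces (a i)) is ++ ps)
  playItems bk a [] G base pbk bnd isG bb cont =
    cont G (λ j pj → Shaped-subst {G} {j} ready (sym (+-identityʳ (base j))) (isG j pj)) bnd
  playItems bk a (i ∷ is) {ps} G base pbk bnd isG bb cont =
    subst (λ z → Win (profileBoard G) z) (sym (++-assoc (itemPieces (a i)) (concatMap (λ i → itemPieces (a i)) is) ps))
    (playItem (a i) G j0 (base j0) (pbk i) bnd (isG j0 (pbk i)) ib (λ G' ag b' →
      playItems bk a is G' base' pbk b' (isG' ag) bb' (λ G'' isG'' b'' → cont G'' (λ j pj → Shaped-subst {G''} {j} ready (assoc j) (isG'' j pj)) b'')))
    where
    j0 = bk i
    δ : ℕ → ℕ
    δ j = if bk i ≡ᵇ j then suc (a i) else 0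
    base' : ℕ → ℕ
    base' j = base j + δ j
    assoc : ∀ j → base' j + load bk a is j ≡ base j + load bk a (i ∷ is) j
    assoc j = +-assoc (base j) (δ j) (load bk a is j)
    bb' : ∀ j → j < s → base' j + load bk a is j ≤ T + 3
    bb' j pj = subst (_≤ T + 3) (sym (assoc j)) (bb j pj)
    δj0 : δ j0 ≡ suc (a i)
    δj0 = if-true (≡ᵇ-refl j0)
    ib : base j0 + a i ≤ T + 2
    ib = ≤-pred (subst (_≤ suc (T + 2)) (+-suc (base j0) (a i))
           (≤-trans (+-monoʳ-≤ (base j0) (≤-trans (≤-reflexive (sym δj0)) (m≤m+n (δ j0) (load bk a is j0))))
             (subst (base j0 + (δ j0 + load bk a is j0) ≤_) (+-suc T 2) (bb j0 (pbk i)))))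
    isG' : ∀ {G'} → Agree G' (setBucket G j0 (ready (suc (base j0 + a i)))) → ∀ j → j < s → Shaped G' j (ready (base' j))
    isG' {G'} ag j pj with j ≟ j0
    ... | yes refl = Shaped-subst {G'} {j0} ready (trans (sym (+-suc (base j0) (a i))) (cong (λ z → base j0 + z) (sym δj0))) (shaped-setBucket ag pj)
    ... | no ne = λ k pk → trans (agree-other ag j ne pj k pk)
            (trans (isG j pj k pk) (cong (λ z → ready z k) (sym (trans (cong (λ z → base j + z) (if-false (≡ᵇ-false (λ e → ne (sym e))))) (+-identityʳ (base j))))))

module Endgame (s T : ℕ) (s≥1 : 1 ≤ s) where
  open Gadgets s T s≥1 public

  flattenBuckets : ∀ k m {ps} G → m + k ≡ s → Bounded G →
    (∀ j → j < m → Shaped G j (flat4 (T + 3))) → (∀ j → m ≤ j → j < s → Shaped G j (ready (T + 3))) →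
    (∀ G' → (∀ j → j < s → Shaped G' j (flat4 (T + 3))) → Bounded G' → Win (profileBoard G') ps) →
    Win (profileBoard G) (replicate k I ++ ps)
  flattenBuckets zero m G e bnd isF isS cont =
    cont G (λ j pj → isF j (subst (j <_) (sym (trans (sym (+-identityʳ m)) e)) pj)) bnd
  flattenBuckets (suc k) m G e bnd isF isS cont =
    I-on-ready G m (T + 3) pm bnd (isS m ≤-refl pm) (≤-reflexive 6[T+3]+4≡H) (λ G' ag b' →
      flattenBuckets k (suc m) G' (trans (sym (+-suc m k)) e) b' (isF' ag) (isS' ag) cont)
    where
    pm : m < s
    pm = subst (m <_) e (subst (_≤ m + suc k) (+-comm m 1) (+-monoʳ-≤ m (s≤s z≤n)))
    isF' : ∀ {G'} → Agree G' (setBucket G m (flat4 (T + 3))) → ∀ j → j < suc m → Shaped G' j (flat4 (T + 3))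
    isF' {G'} ag j pj with j ≟ m
    ... | yes refl = shaped-setBucket ag pm
    ... | no ne = λ k pk → trans (agree-other ag j ne (<-trans jm pm) k pk) (isF j jm k pk)
      where jm : j < m
            jm = ≤∧≢⇒< (≤-pred pj) ne
    isS' : ∀ {G'} → Agree G' (setBucket G m (flat4 (T + 3))) → ∀ j → suc m ≤ j → j < s → Shaped G' j (ready (T + 3))
    isS' {G'} ag j pj ps' k pk = trans (agree-other ag j (λ e → <⇒≢ pj (sym e)) ps' k pk) (isS j (≤-trans (n≤1+n m) pj) ps' k pk)

  wellBoard : ℕ → Board
  wellBoard N h c = (h ≤ᵇ N) ∧ not (c ≡ᵇ 6 * s + 3)

  lockColumn-cases : ∀ c → 6 * s < c → c ≤ 6 * s + 3 → c ≡ 6 * s + 1 ⊎ (c ≡ 6 * s + 2 ⊎ c ≡ 6 * s + 3)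
  lockColumn-cases c p q with c ∸ 6 * s in eq
  ... | 0 = ⊥-elim (<⇒≱ p (m∸n≡0⇒m≤n eq))
  ... | 1 = inj₁ (trans (sym (m+[n∸m]≡n (<⇒≤ p))) (cong (λ z → 6 * s + z) eq))
  ... | 2 = inj₂ (inj₁ (trans (sym (m+[n∸m]≡n (<⇒≤ p))) (cong (λ z → 6 * s + z) eq)))
  ... | 3 = inj₂ (inj₂ (trans (sym (m+[n∸m]≡n (<⇒≤ p))) (cong (λ z → 6 * s + z) eq)))
  ... | suc (suc (suc (suc t))) = ⊥-elim (absurd4 (subst (_≤ 3) eq bound))
    where
    bound : c ∸ 6 * s ≤ 3
    bound = subst (c ∸ 6 * s ≤_) (m+n∸m≡n (6 * s) 3) (∸-monoˡ-≤ (6 * s) q)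
    absurd4 : ¬ (suc (suc (suc (suc t))) ≤ 3)
    absurd4 (s≤s (s≤s (s≤s ())))

  XL yL : ℕ
  XL = 6 * s + 1
  yL = suc (6 * T + 20)

  XL+0 : XL + 0 ≡ 6 * s + 1
  XL+0 = +-identityʳ XL

  XL+1 : XL + 1 ≡ 6 * s + 2
  XL+1 = +-assoc (6 * s) 1 1

  XL+2 : XL + 2 ≡ 6 * s + 3
  XL+2 = +-assoc (6 * s) 1 2

  XL+3≤cols : XL + 3 ≤ suc (cols d)
  XL+3≤cols = ≤-reflexive (ring s)
    where ring : ∀ s → 6 * s + 1 + 3 ≡ 1 + (6 * s + 3)
          ring = solve-∀

  yL%6≡3 : yL % 6 ≡ 3
  yL%6≡3 = trans (cong (_% 6) (ring T)) ([m+kn]%n≡m%n 3 (T + 3) 6)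
    where ring : ∀ T → 1 + (6 * T + 20) ≡ 3 + (T + 3) * 6
          ring = solve-∀
  [1+yL]%6≡4 : suc yL % 6 ≡ 4
  [1+yL]%6≡4 = trans (cong (_% 6) (ring T)) ([m+kn]%n≡m%n 4 (T + 3) 6)
    where ring : ∀ T → 1 + (1 + (6 * T + 20)) ≡ 4 + (T + 3) * 6
          ring = solve-∀

  belowWell-notNotch : ∀ h → h ≤ 6 * T + 20 → (h % 6 ≢ 5) ⊎ (h < 6 * (T + 3))
  belowWell-notNotch h p with h <? 6 * (T + 3)
  ... | yes q = inj₂ q
  ... | no nq = inj₁ (λ e → <⇒≢ (≤-<-trans t≤2 (s≤s (s≤s (s≤s z≤n)))) (trans (sym tm) e))
    where
    ge : 6 * (T + 3) ≤ h
    ge = ≮⇒≥ nq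
    t = h ∸ 6 * (T + 3)
    hq : 6 * (T + 3) + t ≡ h
    hq = m+[n∸m]≡n ge
    t≤2 : t ≤ 2
    t≤2 = +-cancelˡ-≤ (6 * (T + 3)) t 2 (subst (_≤ 6 * (T + 3) + 2) (sym hq) (≤-trans p (≤-reflexive (ring T))))
      where ring : ∀ T → 6 * T + 20 ≡ 6 * (T + 3) + 2
            ring = solve-∀
    tm : h % 6 ≡ t
    tm = trans (cong (_% 6) (trans (sym hq) (trans (+-comm (6 * (T + 3)) t) (cong (λ z → t + z) (*-comm 6 (T + 3))))))
           (trans ([m+kn]%n≡m%n t (T + 3) 6) (m<n⇒m%n≡m (≤-<-trans t≤2 (s≤s (s≤s (s≤s z≤n))))))

  bucketsFull : ∀ G → (∀ j → j < s → Shaped G j (flat4 (T + 3))) → ∀ h c → h ≤ H → 1 ≤ c → c ≤ 6 * s →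
     (h % 6 ≢ 5 ⊎ h < 6 * (T + 3)) → profileBoard G h c ≡ true
  bucketsFull G isF h c hH p1 p2 nt with colOf-view s c p1 p2
  ... | j , k , pj , pk , refl = trans (profileBoard-bucket G j k h pj pk) (cases k pk)
    where
    ntc : (h % 6 ≢ 5 ⊎ h < 6 * (T + 3)) → not (h % 6 ≡ᵇ 5) ∨ (h <ᵇ 6 * (T + 3)) ≡ true
    ntc (inj₁ ne) = ∨-trueˡ _ (cong not (≡ᵇ-false ne))
    ntc (inj₂ lt) = trans (cong (not (h % 6 ≡ᵇ 5) ∨_) (<ᵇ-true lt)) (∨-zeroʳ _)
    nf : notchCell (T + 3) h ≡ true
    nf = trans (∧-trueˡ _ (≤ᵇ-true hH)) (ntc nt)
    lowk : ∀ k → k < 3 → h ≤ G j k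
    lowk k pk = subst (h ≤_) (sym (trans (isF j pj k (<-trans pk (≤-lit 4 5))) (forLowCols {λ k → flat4 (T + 3) k ≡ H} 6[T+3]+4≡H 6[T+3]+4≡H 6[T+3]+4≡H k pk))) hH
    cases : ∀ k → k < 6 → bucketCell k (G j k) h ≡ true
    cases 0 _ = ≤ᵇ-true (lowk 0 (≤-lit 1 3))
    cases 1 _ = ≤ᵇ-true (lowk 1 (≤-lit 2 3))
    cases 2 _ = ≤ᵇ-true (lowk 2 (≤-lit 3 3))
    cases 3 _ = trans (cong (λ z → notchCell z h) (isF j pj 3 (≤-lit 4 5))) nf
    cases 4 _ = trans (cong (λ z → notchCell z h) (isF j pj 4 (≤-lit 5 5))) nf
    cases (suc (suc (suc (suc (suc k))))) _ = ≤ᵇ-true hH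

  yL-eq : yL ≡ 6 * T + 21
  yL-eq = sym (+-suc (6 * T) 20)

  yL2 : yL + 2 ≡ suc H
  yL2 = cong suc (+-assoc (6 * T) 20 2)

  lockPiece : Active
  lockPiece = active RG 2 (+ XL) (+ yL)

  enterLock : ∀ G → Bounded G →
    fits d (profileBoard G) (spawn d RG) ≡ true × Reach d (profileBoard G) (spawn d RG) lockPiece
  enterLock G bnd = proj₁ sp , reach-trans (proj₂ sp) dr
    where
    a = lockPiece
    sp = enterAndAlign (profileBoard G) RG 2 XL 3 (profileBoard-aboveH G bnd) refl refl ≤-refl (≤-trans (s≤s z≤n) (6s<6s+1+ 0)) XL+3≤cols
    yb : yL ≤ spawnY RG
    yb = ≤-trans (≤-reflexive yL-eq) (≤-trans (+-monoʳ-≤ (6 * T) (≤-lit 21 22)) (≤-trans H≤Q (m≤m+n Q 2)))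
    n = spawnY RG ∸ yL
    rowB : ∀ k dy → k ≤ n → dy ≤ 1 → yL + k + dy ≤ rows d
    rowB k dy kn d1 = ≤-trans (+-mono-≤ (+-monoʳ-≤ yL kn) d1) (≤-trans (≤-reflexive (cong (_+ 1) (m+[n∸m]≡n yb)))
      (≤-trans (≤-reflexive (+-assoc Q 2 1)) (+-monoʳ-≤ Q (≤-lit 3 4))))
    gtL : ∀ k dy → 6 * T + 20 < yL + k + dy
    gtL k dy = ≤-trans (m≤m+n yL k) (m≤m+n (yL + k) dy)
    lk1 : ∀ h → 6 * T + 20 < h → profileBoard G h (XL + 0) ≡ false
    lk1 h p = trans (cong (profileBoard G h) XL+0) (trans (profileBoard-lock G h (6 * s + 1) (6s<6s+1+ 0)) (trans (lockCol₁ h) (∧-falseʳ (≤ᵇ-false p))))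
    lk2 : ∀ h → 6 * T + 21 < h → profileBoard G h (XL + 1) ≡ false
    lk2 h p = trans (cong (profileBoard G h) XL+1) (trans (profileBoard-lock G h (6 * s + 2) (6s<6s+1+ 1)) (trans (lockCol₂ h) (∧-falseʳ (≤ᵇ-false p))))
    lk3 : ∀ h → 6 * T + 21 < h → profileBoard G h (XL + 2) ≡ false
    lk3 h p = trans (cong (profileBoard G h) XL+2) (trans (profileBoard-lock G h (6 * s + 3) (6s<6s+1+ 2)) (trans (lockCol₃ h) (∧-falseʳ (≡ᵇ-false (λ e → <⇒≢ p (sym e))))))
    gt21 : ∀ k → 6 * T + 21 < yL + k + 1
    gt21 k = subst (λ z → z < yL + k + 1) yL-eq (subst (yL <_) (sym (+-comm (yL + k) 1)) (s≤s (m≤m+n yL k)))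
    c1 : ∀ dx → dx ≤ 2 → 1 ≤ XL + dx × XL + dx ≤ cols d
    c1 dx p = ≤-trans (s≤s z≤n) (≤-trans (6s<6s+1+ 0) (m≤m+n XL dx)) , ≤-trans (+-monoʳ-≤ XL p) (≤-reflexive XL+2)
    fitsAt : ∀ k → k ≤ n → fits d (profileBoard G) (active RG 2 (+ XL) (+ (yL + k))) ≡ true
    fitsAt k kn = ∧-true₄
      (isOpen-true {profileBoard G} {yL + k + 0} {XL + 0} (≤-trans (s≤s z≤n) (gtL k 0)) (rowB k 0 kn z≤n) (proj₁ (c1 0 z≤n)) (proj₂ (c1 0 z≤n)) (lk1 _ (gtL k 0)))
      (isOpen-true {profileBoard G} {yL + k + 1} {XL + 2} (≤-trans (s≤s z≤n) (gtL k 1)) (rowB k 1 kn ≤-refl) (proj₁ (c1 2 (≤-lit 2 2))) (proj₂ (c1 2 (≤-lit 2 2))) (lk3 _ (gt21 k)))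
      (isOpen-true {profileBoard G} {yL + k + 1} {XL + 1} (≤-trans (s≤s z≤n) (gtL k 1)) (rowB k 1 kn ≤-refl) (proj₁ (c1 1 (≤-lit 1 2))) (proj₂ (c1 1 (≤-lit 1 2))) (lk2 _ (gt21 k)))
      (isOpen-true {profileBoard G} {yL + k + 1} {XL + 0} (≤-trans (s≤s z≤n) (gtL k 1)) (rowB k 1 kn ≤-refl) (proj₁ (c1 0 z≤n)) (proj₂ (c1 0 z≤n)) (lk1 _ (gtL k 1)))
    dr : Reach d (profileBoard G) (active RG 2 (+ XL) (+ spawnY RG)) a
    dr = subst (λ z → Reach d (profileBoard G) (active RG 2 (+ XL) (+ z)) a) (m+[n∸m]≡n yb) (dropDown* RG 2 (+ XL) yL n fitsAt)

  lockPiece-rests : ∀ G → fits d (profileBoard G) (applyMove drop lockPiece) ≡ false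
  lockPiece-rests G = ∧-falseˡ _ (isOpen-false {profileBoard G} {6 * T + 20 + 0} {XL + 0}
      (trans (cong₂ (profileBoard G) (+-identityʳ (6 * T + 20)) XL+0) (trans (profileBoard-lock G _ (6 * s + 1) (6s<6s+1+ 0))
        (trans (lockCol₁ (6 * T + 20)) (trans (∧-trueˡ _ (≤ᵇ-true {6 * T + 20} {H} (+-monoʳ-≤ (6 * T) (≤-lit 20 22)))) (≤ᵇ-true {6 * T + 20} ≤-refl))))))

  lockRows-full : ∀ G → (∀ j → j < s → Shaped G j (flat4 (T + 3))) →
    ∀ h → 6 * T + 20 < h → h ≤ 6 * T + 20 + 2 → fullRow d (place (profileBoard G) lockPiece) h ≡ true
  lockRows-full G isF h p q = all≡true _ (All.map (λ {c} (c1' , c2') → fullCell h c hc c1' c2') (All-oneTo (cols d)))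
    where
    a = lockPiece
    b1 = place (profileBoard G) a
    cellAny : ∀ h c → Any (λ x → eqℤ (proj₁ x) (+ h) ∧ eqℤ (proj₂ x) (+ c) ≡ true) (cellsOf a) → b1 h c ≡ true
    cellAny h c an = trans (cong (profileBoard G h c ∨_) (any≡true (λ x → eqℤ (proj₁ x) (+ h) ∧ eqℤ (proj₂ x) (+ c)) an)) (∨-zeroʳ _)
    fA : ∀ {c} → c ≡ 6 * s + 1 ⊎ (c ≡ 6 * s + 2 ⊎ c ≡ 6 * s + 3) → b1 yL c ≡ true
    fA (inj₁ refl) = cellAny yL (6 * s + 1) (here (cong₂ _∧_ (≡ᵇ-true (+-identityʳ yL)) (≡ᵇ-true XL+0)))
    fA (inj₂ (inj₁ refl)) = ∨-trueˡ _ (trans (profileBoard-lock G yL (6 * s + 2) (6s<6s+1+ 1)) (trans (lockCol₂ yL)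
               (trans (∧-trueˡ _ (≤ᵇ-true (≤-trans (≤-reflexive yL-eq) (+-monoʳ-≤ (6 * T) (≤-lit 21 22))))) (≤ᵇ-true (≤-reflexive yL-eq)))))
    fA (inj₂ (inj₂ refl)) = ∨-trueˡ _ (trans (profileBoard-lock G yL (6 * s + 3) (6s<6s+1+ 2)) (trans (lockCol₃ yL)
               (trans (∧-trueˡ _ (≤ᵇ-true (≤-trans (≤-reflexive yL-eq) (+-monoʳ-≤ (6 * T) (≤-lit 21 22))))) (≡ᵇ-true yL-eq))))
    fB : ∀ {c} → c ≡ 6 * s + 1 ⊎ (c ≡ 6 * s + 2 ⊎ c ≡ 6 * s + 3) → b1 (suc yL) c ≡ true
    fB (inj₁ refl) = cellAny (suc yL) (6 * s + 1) (there (there (there (here (cong₂ _∧_ (≡ᵇ-true (+-comm yL 1)) (≡ᵇ-true XL+0))))))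
    fB (inj₂ (inj₁ refl)) = cellAny (suc yL) (6 * s + 2) (there (there (here (cong₂ _∧_ (≡ᵇ-true (+-comm yL 1)) (≡ᵇ-true XL+1)))))
    fB (inj₂ (inj₂ refl)) = cellAny (suc yL) (6 * s + 3) (there (here (cong₂ _∧_ (≡ᵇ-true (+-comm yL 1)) (≡ᵇ-true XL+2))))
    fullCell : ∀ h c → (h ≡ yL ⊎ h ≡ suc yL) → 1 ≤ c → c ≤ cols d → b1 h c ≡ true
    fullCell h c hc p1 p2 with c ≤? 6 * s
    ... | yes le = ∨-trueˡ _ (bucketsFull G isF h c hH p1 le (inj₁ nt))
      where
      hH : h ≤ H
      hH = [ (λ e → subst (_≤ H) (sym e) (≤-trans (≤-reflexive yL-eq) (+-monoʳ-≤ (6 * T) (≤-lit 21 22)))) , (λ e → subst (_≤ H) (sym e) (≤-reflexive (trans (cong suc yL-eq) (sym (+-suc (6 * T) 21))))) ]′ hc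
      nt : h % 6 ≢ 5
      nt = [ (λ e m → case trans (sym yL%6≡3) (trans (cong (_% 6) (sym e)) m) of λ ()) , (λ e m → case trans (sym [1+yL]%6≡4) (trans (cong (_% 6) (sym e)) m) of λ ()) ]′ hc
    ... | no gt with hc
    ...   | inj₁ e = subst (λ z → b1 z c ≡ true) (sym e) (fA (lockColumn-cases c (≰⇒> gt) p2))
    ...   | inj₂ e = subst (λ z → b1 z c ≡ true) (sym e) (fB (lockColumn-cases c (≰⇒> gt) p2))
    hc : h ≡ yL ⊎ h ≡ suc yL
    hc with m≤n⇒m<n∨m≡n p
    ... | inj₂ e = inj₁ (sym e)
    ... | inj₁ p' with m≤n⇒m<n∨m≡n p'
    ...   | inj₂ e = inj₂ (sym e)
    ...   | inj₁ p'' = ⊥-elim (<⇒≱ p'' (≤-trans q (≤-reflexive (+-comm (6 * T + 20) 2))))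

  profileBoard-belowLock : ∀ G → (∀ j → j < s → Shaped G j (flat4 (T + 3))) →
    ∀ h c → h ≤ 6 * T + 20 → 1 ≤ c → c ≤ cols d → profileBoard G h c ≡ not (c ≡ᵇ 6 * s + 3)
  profileBoard-belowLock G isF h c hle p3 p4 with c ≤? 6 * s
  ... | yes le = trans (bucketsFull G isF h c (≤-trans hle (+-monoʳ-≤ (6 * T) (≤-lit 20 22))) p3 le (belowWell-notNotch h hle))
                  (sym (cong not (≡ᵇ-false (λ e → <⇒≱ (6s<6s+1+ 2) (subst (_≤ 6 * s) e le)))))
  ... | no gt with lockColumn-cases c (≰⇒> gt) p4
  ...   | inj₁ refl = trans (profileBoard-lock G h (6 * s + 1) (6s<6s+1+ 0)) (trans (lockCol₁ h)
             (trans (∧-trueˡ _ (≤ᵇ-true (≤-trans hle (+-monoʳ-≤ (6 * T) (≤-lit 20 22))))) (trans (≤ᵇ-true hle) (cong not (sym (≡ᵇ-cancelˡ (6 * s) 1 3))))))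
  ...   | inj₂ (inj₁ refl) = trans (profileBoard-lock G h (6 * s + 2) (6s<6s+1+ 1)) (trans (lockCol₂ h)
             (trans (∧-trueˡ _ (≤ᵇ-true (≤-trans hle (+-monoʳ-≤ (6 * T) (≤-lit 20 22))))) (trans (≤ᵇ-true (≤-trans hle (+-monoʳ-≤ (6 * T) (≤-lit 20 21)))) (cong not (sym (≡ᵇ-cancelˡ (6 * s) 2 3))))))
  ...   | inj₂ (inj₂ refl) = trans (profileBoard-lock G h (6 * s + 3) (6s<6s+1+ 2)) (trans (lockCol₃ h)
             (trans (∧-falseʳ (≡ᵇ-false (λ e → <⇒≢ (s≤s hle) (trans e (sym yL-eq))))) (cong not (sym (≡ᵇ-refl (6 * s + 3))))))

  -- Turned upside down, the RG piece completes rows 6T+21 and 6T+22 in the lock;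
  -- clearing them leaves the buckets and the first two lock columns full.
  settle-lock : ∀ G → (∀ j → j < s → Shaped G j (flat4 (T + 3))) → Bounded G →
    settle d (profileBoard G) lockPiece ≈ wellBoard (6 * T + 20)
  settle-lock G isF bnd = setEq
    where
    a = lockPiece
    b1 = place (profileBoard G) a
    pa-low : ∀ h c → h < yL → b1 h c ≡ profileBoard G h c
    pa-low h c p = place-elsewhere (profileBoard G) RG 2 XL yL h c 2 refl (inj₁ p)
    pa-high : ∀ h c → suc H ≤ h → b1 h c ≡ profileBoard G h c
    pa-high h c p = place-elsewhere (profileBoard G) RG 2 XL yL h c 2 refl (inj₂ (subst (_≤ h) (sym yL2) p))
    hiF : ∀ h c → H < h → 1 ≤ c → b1 h c ≡ false
    hiF h c p q = trans (pa-high h c p) (profileBoard-aboveH G bnd h c p q)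
    eqR : 6 * T + 20 + (2 + (3 * s + 4)) ≡ rows d
    eqR = ring T s where
      ring : ∀ T s → 6 * T + 20 + (2 + (3 * s + 4)) ≡ 6 * T + 22 + 3 * s + 4
      ring = solve-∀
    h1 : ∀ h → 1 ≤ h → h ≤ 6 * T + 20 → fullRow d b1 h ≡ false
    h1 h _ p = all≡false _ (Any-oneTo (cols d) (6 * s + 3) (≤-trans (s≤s z≤n) (6s<6s+1+ 2)) ≤-refl
      (trans (pa-low h (6 * s + 3) (s≤s p)) (trans (profileBoard-lock G h (6 * s + 3) (6s<6s+1+ 2)) (trans (lockCol₃ h)
        (∧-falseʳ (≡ᵇ-false (λ e → <⇒≢ (s≤s p) (trans e (sym yL-eq)))))))))
    h2 : ∀ h → 6 * T + 20 < h → h ≤ 6 * T + 20 + 2 → fullRow d b1 h ≡ true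
    h2 = lockRows-full G isF
    h3 : ∀ h → 6 * T + 20 + 2 < h → h ≤ rows d → fullRow d b1 h ≡ false
    h3 h p _ = all≡false _ (Any-oneTo (cols d) 1 ≤-refl (≤-trans (s≤s z≤n) 4≤cols)
      (hiF h 1 (subst (_< h) (+-assoc (6 * T) 20 2) p) ≤-refl))
    module BB = ClearBand b1 (6 * T + 20) 2 (3 * s + 4) eqR h1 h2 h3
    setEq : settle d (profileBoard G) a ≈ wellBoard (6 * T + 20)
    setEq (suc r) c p1 p2 p3 p4 with r <? 6 * T + 20
    ... | yes lt = trans (BB.clear-low r c lt) (trans (pa-low (suc r) c (s≤s lt))
                     (trans (profileBoard-belowLock G isF (suc r) c lt p3 p4) (sym (∧-trueˡ _ (≤ᵇ-true lt)))))
    ... | no nlt with r <? 6 * T + 20 + (3 * s + 4)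
    ...   | yes lt2 = trans (BB.clear-mid r c (≮⇒≥ nlt) lt2) (trans (hiF (suc (r + 2)) c hi p3) (sym (∧-falseˡ _ (≤ᵇ-false (s≤s (≮⇒≥ nlt))))))
      where hi : H < suc (r + 2)
            hi = s≤s (subst (_≤ r + 2) (+-assoc (6 * T) 20 2) (+-monoˡ-≤ 2 (≮⇒≥ nlt)))
    ...   | no nlt2 = trans (BB.clear-high r c (≮⇒≥ nlt2)) (sym (∧-falseˡ _ (≤ᵇ-false (s≤s (≮⇒≥ nlt)))))


  playLock : ∀ {ps} G → (∀ j → j < s → Shaped G j (flat4 (T + 3))) → Bounded G →
    Win (wellBoard (6 * T + 20)) ps → Win (profileBoard G) (RG ∷ ps)
  playLock G isF bnd win = win-turn lockPiece (proj₁ (enterLock G bnd)) (proj₂ (enterLock G bnd)) (lockPiece-rests G)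
    (win-resp (≈-sym (settle-lock G isF bnd)) win)

  4[1+n]≡4+4n : ∀ n → 4 * suc n ≡ 4 + 4 * n
  4[1+n]≡4+4n = solve-∀

  inColumn2 : ℕ × ℕ → Bool
  inColumn2 (dx , dy) = (dx ≡ᵇ 2) ∧ (dy <ᵇ 4)

  onBottomRow : ℕ × ℕ → Bool
  onBottomRow (dx , dy) = dy ≡ᵇ 0

  for1to4 : ∀ {P : ℕ → Set} → P 1 → P 2 → P 3 → P 4 → ∀ h → 0 < h → h ≤ 4 → P h
  for1to4 p1 p2 p3 p4 1 _ _ = p1
  for1to4 p1 p2 p3 p4 2 _ _ = p2
  for1to4 p1 p2 p3 p4 3 _ _ = p3
  for1to4 p1 p2 p3 p4 4 _ _ = p4
  for1to4 p1 p2 p3 p4 (suc (suc (suc (suc (suc h))))) _ (s≤s (s≤s (s≤s (s≤s ()))))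

  wellPiece : Active
  wellPiece = active I 1 (+ XL) (+ 1)

  enterWell : ∀ N → N ≤ H →
    fits d (wellBoard N) (spawn d I) ≡ true × Reach d (wellBoard N) (spawn d I) wellPiece
  enterWell N N≤H = proj₁ sp , reach-trans (proj₂ sp) dr
    where
    a = wellPiece
    te : EmptyAboveH (wellBoard N)
    te h c hh _ = ∧-falseˡ _ (≤ᵇ-false (≤-<-trans N≤H hh))
    sp = enterAndAlign (wellBoard N) I 1 XL 3 te refl refl (≤-lit 3 4) (≤-trans (s≤s z≤n) (6s<6s+1+ 0)) XL+3≤cols
    n' = spawnY I ∸ 1
    y1 : 1 ≤ spawnY I
    y1 = ≤-trans (s≤s z≤n) (H<spawnY I)
    col2 : ∀ dx → dx ≡ 2 → XL + dx ≡ 6 * s + 3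
    col2 dx refl = XL+2
    fitsAt : ∀ k → k ≤ n' → fits d (wellBoard N) (active I 1 (+ XL) (+ (1 + k))) ≡ true
    fitsAt k kn = fits-cellwise (wellBoard N) I 1 XL (1 + k) inColumn2 refl cell
      where
      cell : ∀ dx dy → inColumn2 (dx , dy) ≡ true → isOpen d (wellBoard N) (+ (1 + k + dy)) (+ (XL + dx)) ≡ true
      cell dx dy q with ∧-true⁻ {dx ≡ᵇ 2} q
      ... | q1 , q2 = isOpen-true {wellBoard N} {1 + k + dy} {XL + dx} (s≤s z≤n)
          (≤-trans (+-mono-≤ (+-monoʳ-≤ 1 kn) (≤-pred (<ᵇ⇒< dy 4 (≡true⇒T q2))))
             (≤-reflexive (trans (cong (_+ 3) (m+[n∸m]≡n y1)) (trans (+-assoc Q 1 3) refl))))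
          (≤-trans (s≤s z≤n) (≤-trans (6s<6s+1+ 0) (m≤m+n XL dx)))
          (≤-reflexive (col2 dx (≡ᵇ-true⇒≡ q1)))
          (∧-falseʳ (cong not (≡ᵇ-true (col2 dx (≡ᵇ-true⇒≡ q1)))))
    dr : Reach d (wellBoard N) (active I 1 (+ XL) (+ spawnY I)) a
    dr = subst (λ z → Reach d (wellBoard N) (active I 1 (+ XL) (+ z)) a) (m+[n∸m]≡n y1) (dropDown* I 1 (+ XL) 1 n' fitsAt)

  wellPiece-rests : ∀ N → fits d (wellBoard N) (applyMove drop wellPiece) ≡ false
  wellPiece-rests N = fits-blocked (wellBoard N) I 1 XL 0 onBottomRow refl cell
      where
      cell : ∀ dx dy → onBottomRow (dx , dy) ≡ true → isOpen d (wellBoard N) (+ (0 + dy)) (+ (XL + dx)) ≡ false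
      cell dx dy q with ≡ᵇ-true⇒≡ {dy} {0} q
      ... | refl = refl

  wellRows-full : ∀ n h → 0 < h → h ≤ 4 → fullRow d (place (wellBoard (4 * suc n)) wellPiece) h ≡ true
  wellRows-full n h ph qh = all≡true _ (All.map (λ {c} (c1' , c2') → fullCell c c1' c2') (All-oneTo (cols d)))
    where
    N = 4 * suc n
    a = wellPiece
    b1 = place (wellBoard N) a
    fullCell : ∀ c → 1 ≤ c → c ≤ cols d → b1 h c ≡ true
    fullCell c p1 p2 with c ≟ 6 * s + 3
    ... | no ne = ∨-trueˡ _ (trans (∧-trueˡ _ (≤ᵇ-true (≤-trans qh (≤-trans (m≤m+n 4 (4 * n)) (≤-reflexive (sym (4[1+n]≡4+4n n)))))))
                    (cong not (≡ᵇ-false ne)))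
    ... | yes refl = trans (cong (wellBoard N h (6 * s + 3) ∨_) (any≡true (λ x → eqℤ (proj₁ x) (+ h) ∧ eqℤ (proj₂ x) (+ (6 * s + 3)))
                 (for1to4 {λ h → Any (λ x → eqℤ (proj₁ x) (+ h) ∧ eqℤ (proj₂ x) (+ (6 * s + 3)) ≡ true) (cellsOf a)}
                   (there (there (there (here (≡ᵇ-true XL+2)))))
                   (there (there (here (≡ᵇ-true XL+2))))
                   (there (here (≡ᵇ-true XL+2)))
                   (here (≡ᵇ-true XL+2)) h ph qh))) (∨-zeroʳ _)

  settle-well : ∀ n → 4 * suc n ≤ 6 * T + 20 → settle d (wellBoard (4 * suc n)) wellPiece ≈ wellBoard (4 * n)
  settle-well n p = setEq
    where
    N = 4 * suc n
    a = wellPiece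
    p' : 4 * n ≤ 6 * T + 20
    p' = ≤-trans (*-monoʳ-≤ 4 (n≤1+n n)) p
    b1 = place (wellBoard N) a
    pa : ∀ h c → 5 ≤ h → b1 h c ≡ wellBoard N h c
    pa h c q = place-elsewhere (wellBoard N) I 1 XL 1 h c 4 refl (inj₂ q)
    R4 : 4 ≤ rows d
    R4 = ≤-trans (≤-lit 4 22) (≤-trans (m≤n+m 22 (6 * T)) (≤-trans H≤Q (m≤m+n Q 4)))
    eqR : 0 + (4 + (rows d ∸ 4)) ≡ rows d
    eqR = m+[n∸m]≡n R4
    h1 : ∀ h → 1 ≤ h → h ≤ 0 → fullRow d b1 h ≡ false
    h1 .zero () z≤n
    h2 : ∀ h → 0 < h → h ≤ 0 + 4 → fullRow d b1 h ≡ true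
    h2 = wellRows-full n
    h3 : ∀ h → 0 + 4 < h → h ≤ rows d → fullRow d b1 h ≡ false
    h3 h ph _ = all≡false _ (Any-oneTo (cols d) (6 * s + 3) (≤-trans (s≤s z≤n) (6s<6s+1+ 2)) ≤-refl
      (trans (pa h (6 * s + 3) ph) (∧-falseʳ (cong not (≡ᵇ-refl (6 * s + 3))))))
    module BB = ClearBand b1 0 4 (rows d ∸ 4) eqR h1 h2 h3
    setEq : settle d (wellBoard N) a ≈ wellBoard (4 * n)
    setEq (suc r) c p1 p2 p3 p4 with r <? rows d ∸ 4
    ... | yes lt = trans (BB.clear-mid r c z≤n lt) (trans (pa (suc (r + 4)) c (s≤s (m≤n+m 4 r)))
          (cong (_∧ not (c ≡ᵇ 6 * s + 3)) (≤ᵇ-cong-⇔ f g)))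
      where
      e5 : suc (r + 4) ≡ 4 + suc r
      e5 = trans (cong suc (+-comm r 4)) refl
      f : suc (r + 4) ≤ 4 * suc n → suc r ≤ 4 * n
      f q = +-cancelˡ-≤ 4 (suc r) (4 * n) (subst₂ _≤_ e5 (4[1+n]≡4+4n n) q)
      g : suc r ≤ 4 * n → suc (r + 4) ≤ 4 * suc n
      g q = subst₂ _≤_ (sym e5) (sym (4[1+n]≡4+4n n)) (+-monoʳ-≤ 4 q)
    ... | no nlt = trans (BB.clear-high r c (≮⇒≥ nlt)) (sym (∧-falseˡ _ (≤ᵇ-false (s≤s big))))
      where
      big : 4 * n ≤ r
      big = ≤-trans p' (≤-trans (+-monoʳ-≤ (6 * T) (≤-lit 20 22)) (≤-trans H≤Q (≤-trans (≤-reflexive (sym (m+n∸n≡m Q 4))) (≮⇒≥ nlt))))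

  clearWell : ∀ n → 4 * n ≤ 6 * T + 20 → Win (wellBoard (4 * n)) (replicate n I)
  clearWell zero _ = win-finish (λ r c p1 _ _ _ → ∧-falseˡ _ (≤ᵇ-false p1))
  clearWell (suc n) p = win-turn wellPiece (proj₁ enter) (proj₂ enter) (wellPiece-rests (4 * suc n))
    (win-resp (≈-sym (settle-well n p)) (clearWell n (≤-trans (*-monoʳ-≤ 4 (n≤1+n n)) p)))
    where
    enter = enterWell (4 * suc n) (≤-trans p (+-monoʳ-≤ (6 * T) (≤-lit 20 22)))

  endgame : T ≡ 2 * ⌊ T /2⌋ → ∀ G → (∀ j → j < s → Shaped G j (ready (T + 3))) → Bounded G →
    Win (profileBoard G) (replicate s I ++ RG ∷ replicate (3 * ⌊ T /2⌋ + 5) I)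
  endgame evenT G isReady bnd = flattenBuckets s 0 G refl bnd (λ j ()) (λ j _ pj → isReady j pj)
    (λ G' isFlat bnd' → playLock G' isFlat bnd'
      (subst (λ N → Win (wellBoard N) (replicate n I)) wellDepth (clearWell n (≤-reflexive wellDepth))))
    where
    n = 3 * ⌊ T /2⌋ + 5
    wellDepth : 4 * n ≡ 6 * T + 20
    wellDepth = trans (ring ⌊ T /2⌋) (cong (λ t → 6 * t + 20) (sym evenT))
      where ring : ∀ q → 4 * (3 * q + 5) ≡ 6 * (2 * q) + 20
            ring = solve-∀

mainTheorem4 : ∀ (s : ℕ) (a : Fin (3 * s) → ℕ) (T : ℕ) →
    1 ≤ s →
    Restricted3Partition s a T →
    YesInstance s a T →
    Σ Board (λ b' → Game (gameDims s T) (initBoard s T) (pieceSeq s a T) b'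
                    × EmptyBoard (gameDims s T) b')
mainTheorem4 s a T s≥1 R3 (f , hf) =
  win-resp (≈-sym initBoard≈profileBoard)
    (playItems (F.toℕ ∘ f) a (L.allFin (3 * s)) initialProfile (λ _ → 0) (FP.toℕ<n ∘ f) initialProfile-bounded
      (λ _ _ _ _ → refl) (λ j pj → ≤-reflexive (fullLoad j pj))
      (λ G isReady bnd → endgame evenT G (λ j pj → Shaped-subst {G} {j} ready (fullLoad j pj) (isReady j pj)) bnd))
  where
  open Endgame s T s≥1
  open Restricted3Partition R3

  fullLoad : ∀ j → j < s → load (F.toℕ ∘ f) a (L.allFin (3 * s)) j ≡ T + 3
  fullLoad j pj = begin
    load (F.toℕ ∘ f) a (L.allFin (3 * s)) j         ≡⟨ cong (load (F.toℕ ∘ f) a (L.allFin (3 * s))) (sym (FP.toℕ-fromℕ< pj)) ⟩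
    load (F.toℕ ∘ f) a (L.allFin (3 * s)) (F.toℕ j') ≡⟨ load-allFin f a j' ⟩
    ∣ preimage f j' ∣ + subsetSum a (preimage f j') ≡⟨ cong₂ _+_ (onlyTriples (preimage f j') (hf j')) (hf j') ⟩
    3 + T                                           ≡⟨ +-comm 3 T ⟩
    T + 3                                           ∎
    where
    open ≡-Reasoning
    j' = F.fromℕ< pj
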